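{- Let $(\alpha_n(a,k,q),\beta_n(a,k,q))_{n\ge0}$ satisfy, for all parameters $a,k$, all bases $q$, and all $n\ge0$, \[ \beta_{n}(a,k,q) = \sum_{j=0}^{n}\frac{(k/a;q)_{n-j}(k;q)_{n+j}}{(q;q)_{n-j}(aq;q)_{n+j}}\alpha_{j}(a,k,q). \] Let $(g_n)$ be an arbitrary sequence and $e,c$ arbitrary constants. Define $\alpha_n'(a,k,q^2) = g_n\alpha_n(e,c,q)$ and \[ \beta_{n}'(a,k,q^2)= \sum_{j=0}^{n}\beta_{j}(e,c,q)\frac{(1-c q^{2j})(k/a;q^2)_{n-j}(k;q^2)_{n+j}(eq;q)_{2j}}{(1-c)(q^2;q^2)_{n-j}(aq^2;q^2)_{n+j}(cq;q)_{2j}} \sum_{r=0}^{n-j}\frac{(1-eq^{2j+2r})(q^{ -2(n-j)},kq^{2n+2j};q^2)_r(e/c,eq^{2j};q)_r\, g_{r+j}}{(1-e q^{2j})(a q^{2n+2j+2},a q^{2-2(n-j)}/k;q^2)_r(cq^{2j+1},q;q)_r}\left(\frac{q^2 c a}{k e}\right)^r. \] Then $(\alpha_n'(a,k,q^2),\beta_n'(a,k,q^2))$ satisfies the relation in base $q^2$: $\beta_n'(a,k,q^2)=\sum_{j=0}^{n}\frac{(k/a;q^2)_{n-j}(k;q^2)_{n+j}}{(q^2;q^2)_{n-j}(aq^2;q^2)_{n+j}}\alpha_j'(a,k,q^2)$ for all $n\ge0$.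
   Context: $(x;q)_n=\prod_{i=0}^{n-1}(1-xq^i)$, $(x_1,\dots,x_m;q)_n=\prod_i(x_i;q)_n$. Parameters are generic so denominators are nonzero. -}

module Defs where

open import Level using (Level; _⊔_) renaming (suc to lsuc)
open import Algebra.Bundles using (CommutativeRing)
open import Data.Nat using (ℕ; zero; suc; _∸_) renaming (_+_ to _+ℕ_; _*_ to _*ℕ_)
open import Relation.Nullary using (¬_)

-- A field: a commutative ring with 0 ≠ 1 and a (total) inverse operation
-- which is a genuine multiplicative inverse on every nonzero element.
-- (The value of 0 ⁻¹ is unconstrained and is never relevant: every
-- denominator used below is assumed nonzero.)
record Field (c ℓ : Level) : Set (lsuc (c ⊔ ℓ)) where
  field
    commutativeRing : CommutativeRing c ℓ
  open CommutativeRing commutativeRing public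
  infix 8 _⁻¹
  field
    _⁻¹       : Carrier → Carrier
    ⁻¹-cong   : ∀ {x y} → x ≈ y → x ⁻¹ ≈ y ⁻¹
    ⁻¹-inverse : ∀ x → ¬ (x ≈ 0#) → x * x ⁻¹ ≈ 1#
    0≉1       : ¬ (0# ≈ 1#)

module QSeries {c ℓ : Level} (F : Field c ℓ) where
  open Field F public

  infixl 6 _−_
  infixl 7 _/_
  infixr 8 _^_

  _−_ : Carrier → Carrier → Carrier
  x − y = x + (- y)

  _/_ : Carrier → Carrier → Carrier
  x / y = x * y ⁻¹

  _≉0 : Carrier → Set ℓ
  x ≉0 = ¬ (x ≈ 0#)

  _^_ : Carrier → ℕ → Carrier
  x ^ zero  = 1#
  x ^ suc n = x * x ^ n

  poch : Carrier → Carrier → ℕ → Carrier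
  poch x q zero    = 1#
  poch x q (suc n) = poch x q n * (1# − x * q ^ n)

  Σ≤ : ℕ → (ℕ → Carrier) → Carrier
  Σ≤ zero    f = f 0
  Σ≤ (suc n) f = Σ≤ n f + f (suc n)

  kernel : Carrier → Carrier → Carrier → ℕ → ℕ → Carrier
  kernel a k q n j =
    (poch (k / a) q (n ∸ j) * poch k q (n +ℕ j))
      / (poch q q (n ∸ j) * poch (a * q) q (n +ℕ j))

  IsPair : (ℕ → Carrier → Carrier → Carrier → Carrier)
         → (ℕ → Carrier → Carrier → Carrier → Carrier) → Set (c ⊔ ℓ)
  IsPair α β = ∀ a k q → a ≉0 → (∀ m → poch q q m ≉0)
             → (∀ m → poch (a * q) q m ≉0)
             → ∀ n → β n a k q ≈ Σ≤ n (λ j → kernel a k q n j * α j a k q)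

  α′ : (ℕ → Carrier → Carrier → Carrier → Carrier) → (ℕ → Carrier)
     → Carrier → Carrier → Carrier → ℕ → Carrier
  α′ α g e cc q n = g n * α n e cc q

  β′ : (ℕ → Carrier → Carrier → Carrier → Carrier) → (ℕ → Carrier)
     → Carrier → Carrier → Carrier → Carrier → Carrier → ℕ → Carrier
  β′ β g a k e cc q n = Σ≤ n λ j →
      β j e cc q
      * (((1# − cc * q ^ (2 *ℕ j)) * poch (k / a) q² (n ∸ j) * poch k q² (n +ℕ j)
            * poch (e * q) q (2 *ℕ j))
         / ((1# − cc) * poch q² q² (n ∸ j) * poch (a * q²) q² (n +ℕ j)
            * poch (cc * q) q (2 *ℕ j)))
      * Σ≤ (n ∸ j) λ r →
          ((1# − e * q ^ (2 *ℕ j +ℕ 2 *ℕ r))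
             * poch (q⁻¹ ^ (2 *ℕ (n ∸ j))) q² r * poch (k * q ^ (2 *ℕ n +ℕ 2 *ℕ j)) q² r
             * poch (e / cc) q r * poch (e * q ^ (2 *ℕ j)) q r * g (r +ℕ j))
          / ((1# − e * q ^ (2 *ℕ j))
             * poch (a * q ^ (2 *ℕ n +ℕ 2 *ℕ j +ℕ 2)) q² r
             * poch (a * q² * q⁻¹ ^ (2 *ℕ (n ∸ j)) / k) q² r
             * poch (cc * q ^ (2 *ℕ j +ℕ 1)) q r * poch q q r)
          * ((q² * cc * a) / (k * e)) ^ r
    where
      q² = q * q
      q⁻¹ = q ⁻¹

  -- genericity: every denominator occurring in β', in the target relation
  -- (base q^2), and in the hypothesis relation at parameters (e,c,q), is nonzero.
  Generic : Carrier → Carrier → Carrier → Carrier → Carrier → Set ℓ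
  Generic a k e cc q =
    (q ≉0) × (a ≉0) × (k ≉0) × (e ≉0) × (cc ≉0) × ((1# − cc) ≉0)
    × (∀ m → poch q q m ≉0)
    × (∀ m → poch (e * q) q m ≉0)
    × (∀ m → poch (cc * q) q m ≉0)
    × (∀ m → poch (q * q) (q * q) m ≉0)
    × (∀ m → poch (a * (q * q)) (q * q) m ≉0)
    × (∀ j → (1# − e * q ^ (2 *ℕ j)) ≉0)
    × (∀ s r → poch (a * q ^ (2 *ℕ s +ℕ 2)) (q * q) r ≉0)
    × (∀ t r → poch (a * (q * q) * (q ⁻¹) ^ (2 *ℕ t) / k) (q * q) r ≉0)
    × (∀ j r → poch (cc * q ^ (2 *ℕ j +ℕ 1)) q r ≉0)
    where open import Data.Product using (_×_)

{-# OPTIONS --safe #-}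
module Submission where

-- The hypothesis says β = K α for the lower-triangular matrix K(n, j) = kernel e c q n j.
-- This matrix has an explicit lower-triangular inverse K⁻¹; the orthogonality
-- Σ_j K⁻¹(m, j) K(j, i) = δ_{mi} holds because the partial sums over j telescope to a
-- closed product that vanishes once the last term is added.  After reversing the
-- base-q² Pochhammer symbols with negative exponents, the (j, r) summand of β′ is
-- β_j(e, c, q) g_{j+r} K_{q²}(n, j+r) K⁻¹(j+r, j); summing over j first for fixed
-- m = j + r turns Σ_j K⁻¹(m, j) β_j into α_m, and what remains is Σ_m K_{q²}(n, m) g_m α_m.

open import Defs
open import Level using (Level; _⊔_)
open import Algebra.Bundles using (CommutativeRing; CommutativeMonoid)
open import Algebra.Solver.Ring.AlmostCommutativeRing
  using (_-Raw-AlmostCommutative⟶_; Induced-equivalence; fromCommutativeRing)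
open import Data.Nat as ℕ using (ℕ; zero; suc; _∸_; _≤_; _<_; z≤n; s≤s) renaming (_+_ to _+ℕ_; _*_ to _*ℕ_)
import Data.Nat.Properties as ℕP
open import Data.Nat.Tactic.RingSolver using (solve-∀)
open import Data.Integer as ℤ using (ℤ; +_; -[1+_]; _⊖_; _◃_; sign; ∣_∣)
import Data.Integer.Properties as ℤP
open import Data.Sign as Sign using (Sign)
open import Data.Maybe using (just; nothing)
open import Data.List using (List; []; _∷_)
open import Data.Nat.ListAction using (sum)
open import Data.Vec as Vec using (Vec; []; _∷_; lookup)
open import Data.Vec.N-ary using (N-ary; _$ⁿ_)
open import Data.Fin as Fin using (Fin)
open import Data.Product using (_,_; proj₁; proj₂)
open import Relation.Nullary using (yes; no)
open import Function using (_∘_)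
open import Relation.Binary.Definitions using (WeaklyDecidable)
import Relation.Binary.PropositionalEquality as PE

-- Integer coefficients make numerals cancel (1 − 1 = 0), which the reflective solver,
-- whose coefficients live in the ring itself, cannot do.
module IntegerRingSolver {c ℓ : Level} (R : CommutativeRing c ℓ) where
  open CommutativeRing R
  open import Algebra.Properties.Ring ring using (-‿involutive; -‿distribˡ-*; -‿distribʳ-*; -0#≈0#; -‿+-comm)
  open import Algebra.Properties.Semiring.Mult.TCOptimised semiring using (1+×; ×-homo-+; ×1-homo-*) renaming (_×_ to _·_)
  open import Algebra.Properties.Semiring.Exp semiring using (^-congˡ)
  open import Data.Product using (_×_)
  open import Relation.Binary.Reasoning.Setoid setoid
  open import Algebra.Solver.CommutativeMonoid +-commutativeMonoid using (solve; _⊜_; _⊕_)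

  +-interchange : ∀ a b x y → a + b + x + y ≈ (a + x) + (b + y)
  +-interchange = solve 4 (λ a b x y → ((a ⊕ b) ⊕ x) ⊕ y ⊜ (a ⊕ x) ⊕ (b ⊕ y)) refl

  fromℕ : ℕ → Carrier
  fromℕ n = n · 1#

  fromℤ : ℤ → Carrier
  fromℤ (+ n)    = fromℕ n
  fromℤ -[1+ n ] = - fromℕ (suc n)

  fromℤ-neg : ∀ i → fromℤ (ℤ.- i) ≈ - fromℤ i
  fromℤ-neg (+ zero)  = sym -0#≈0#
  fromℤ-neg (+ suc n) = refl
  fromℤ-neg -[1+ n ]  = sym (-‿involutive _)

  fromℤ-⊖ : ∀ m n → fromℤ (m ⊖ n) ≈ fromℕ m - fromℕ n
  fromℤ-⊖ m zero = begin
    fromℤ (m ⊖ 0)       ≡⟨ PE.cong fromℤ (ℤP.⊖-≥ {m} ℕ.z≤n) ⟩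
    fromℕ m             ≈⟨ sym (+-identityʳ _) ⟩
    fromℕ m + 0#        ≈⟨ +-congˡ (sym -0#≈0#) ⟩
    fromℕ m - 0#        ∎
  fromℤ-⊖ zero (suc n) = sym (+-identityˡ _)
  fromℤ-⊖ (suc m) (suc n) = begin
    fromℤ (suc m ⊖ suc n)              ≡⟨ PE.cong fromℤ (ℤP.[1+m]⊖[1+n]≡m⊖n m n) ⟩
    fromℤ (m ⊖ n)                      ≈⟨ fromℤ-⊖ m n ⟩
    fromℕ m - fromℕ n                  ≈⟨ +-congʳ (sym (+-identityˡ _)) ⟩
    0# + fromℕ m - fromℕ n             ≈⟨ +-congʳ (+-congʳ (sym (-‿inverseʳ 1#))) ⟩
    1# - 1# + fromℕ m - fromℕ n        ≈⟨ +-interchange 1# (- 1#) (fromℕ m) (- fromℕ n) ⟩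
    (1# + fromℕ m) + (- 1# - fromℕ n)  ≈⟨ +-congˡ (-‿+-comm 1# (fromℕ n)) ⟩
    (1# + fromℕ m) - (1# + fromℕ n)    ≈⟨ sym (+-cong (1+× m 1#) (-‿cong (1+× n 1#))) ⟩
    fromℕ (suc m) - fromℕ (suc n)      ∎

  fromℤ-+ : ∀ i j → fromℤ (i ℤ.+ j) ≈ fromℤ i + fromℤ j
  fromℤ-+ -[1+ m ] -[1+ n ] = begin
    - fromℕ (suc (suc (m ℕ.+ n)))        ≈⟨ -‿cong (1+× (suc (m ℕ.+ n)) 1#) ⟩
    - (1# + fromℕ (suc m ℕ.+ n))          ≈⟨ -‿cong (+-congˡ (×-homo-+ 1# (suc m) n)) ⟩
    - (1# + (fromℕ (suc m) + fromℕ n))    ≈⟨ -‿cong (x+[y+z]≈y+[x+z] 1# _ _) ⟩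
    - (fromℕ (suc m) + (1# + fromℕ n))    ≈⟨ -‿cong (+-congˡ (sym (1+× n 1#))) ⟩
    - (fromℕ (suc m) + fromℕ (suc n))     ≈⟨ -‿+-comm _ _ ⟨
    - fromℕ (suc m) + - fromℕ (suc n)     ∎
    where
    x+[y+z]≈y+[x+z] : ∀ x y z → x + (y + z) ≈ y + (x + z)
    x+[y+z]≈y+[x+z] = solve 3 (λ x y z → x ⊕ (y ⊕ z) ⊜ y ⊕ (x ⊕ z)) refl
  fromℤ-+ -[1+ m ] (+ n)    = trans (fromℤ-⊖ n (suc m)) (+-comm _ _)
  fromℤ-+ (+ m)    -[1+ n ] = fromℤ-⊖ m (suc n)
  fromℤ-+ (+ m)    (+ n)    = ×-homo-+ 1# m n

  signed : Sign → Carrier → Carrier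
  signed Sign.+ x = x
  signed Sign.- x = - x

  fromℤ-sign : ∀ i → fromℤ i ≈ signed (sign i) (fromℕ ∣ i ∣)
  fromℤ-sign (+ zero)  = refl
  fromℤ-sign (+ suc n) = refl
  fromℤ-sign -[1+ n ]  = refl

  fromℤ-◃ : ∀ s n → fromℤ (s ◃ n) ≈ signed s (fromℕ n)
  fromℤ-◃ Sign.+ zero    = refl
  fromℤ-◃ Sign.- zero    = sym -0#≈0#
  fromℤ-◃ Sign.+ (suc n) = refl
  fromℤ-◃ Sign.- (suc n) = refl

  signed-* : ∀ s t x y → signed (s Sign.* t) (x * y) ≈ signed s x * signed t y
  signed-* Sign.+ Sign.+ x y = refl
  signed-* Sign.+ Sign.- x y = -‿distribʳ-* x y
  signed-* Sign.- Sign.+ x y = -‿distribˡ-* x y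
  signed-* Sign.- Sign.- x y = begin
    x * y           ≈⟨ -‿involutive _ ⟨
    - - (x * y)     ≈⟨ -‿cong (-‿distribˡ-* x y) ⟩
    - (- x * y)     ≈⟨ -‿distribʳ-* (- x) y ⟩
    - x * - y       ∎

  fromℤ-* : ∀ i j → fromℤ (i ℤ.* j) ≈ fromℤ i * fromℤ j
  fromℤ-* i j = begin
    fromℤ ((sign i Sign.* sign j) ◃ (∣ i ∣ ℕ.* ∣ j ∣))        ≈⟨ fromℤ-◃ (sign i Sign.* sign j) (∣ i ∣ ℕ.* ∣ j ∣) ⟩
    signed (sign i Sign.* sign j) (fromℕ (∣ i ∣ ℕ.* ∣ j ∣))   ≈⟨ signed-cong (sign i Sign.* sign j) (×1-homo-* ∣ i ∣ ∣ j ∣) ⟩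
    signed (sign i Sign.* sign j) (fromℕ ∣ i ∣ * fromℕ ∣ j ∣) ≈⟨ signed-* (sign i) (sign j) _ _ ⟩
    signed (sign i) (fromℕ ∣ i ∣) * signed (sign j) (fromℕ ∣ j ∣) ≈⟨ *-cong (fromℤ-sign i) (fromℤ-sign j) ⟨
    fromℤ i * fromℤ j ∎
    where
    signed-cong : ∀ s {x y} → x ≈ y → signed s x ≈ signed s y
    signed-cong Sign.+ = λ p → p
    signed-cong Sign.- = -‿cong

  fromℤ-morphism : ℤ.+-*-rawRing -Raw-AlmostCommutative⟶ fromCommutativeRing R
  fromℤ-morphism = record
    { ⟦_⟧ = fromℤ ; +-homo = fromℤ-+ ; *-homo = fromℤ-* ; -‿homo = fromℤ-neg
    ; 0-homo = refl ; 1-homo = refl }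

  fromℤ-≟ : WeaklyDecidable (Induced-equivalence fromℤ-morphism)
  fromℤ-≟ i j with i ℤ.≟ j
  ... | yes PE.refl = just refl
  ... | no _        = nothing

  open import Algebra.Solver.Ring ℤ.+-*-rawRing (fromCommutativeRing R) fromℤ-morphism fromℤ-≟ public
    using (Polynomial; Op; op; var; con; _:^_; :-_; _:+_; _:*_; _:-_; ⟦_⟧; ⟦_⟧↓; prove; solve; _:=_)
  open Op

  substitute : ∀ {n m} → Vec (Polynomial m) n → Polynomial n → Polynomial m
  substitute σ (op o p₁ p₂) = op o (substitute σ p₁) (substitute σ p₂)
  substitute σ (con c)      = con c
  substitute σ (var i)      = lookup σ i
  substitute σ (p :^ k)     = substitute σ p :^ k
  substitute σ (:- p)       = :- substitute σ p

  data Substitution {m} (ρm : Vec Carrier m) : ∀ {n} → Vec Carrier n → Vec (Polynomial m) n → Set (c ⊔ ℓ) where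
    []  : Substitution ρm [] []
    _∷_ : ∀ {n x e} {xs : Vec Carrier n} {es} →
          x ≈ ⟦ e ⟧ ρm → Substitution ρm xs es → Substitution ρm (x ∷ xs) (e ∷ es)

  substitution-lookup : ∀ {n m} {ρm : Vec Carrier m} {ρ : Vec Carrier n} {σ} →
                        Substitution ρm ρ σ → ∀ i → lookup ρ i ≈ ⟦ lookup σ i ⟧ ρm
  substitution-lookup (p ∷ _) Fin.zero    = p
  substitution-lookup (_ ∷ r) (Fin.suc i) = substitution-lookup r i

  substitute-correct : ∀ {n m} (p : Polynomial n) {σ : Vec (Polynomial m) n} {ρm : Vec Carrier m} {ρ : Vec Carrier n} →
                       Substitution ρm ρ σ → ⟦ p ⟧ ρ ≈ ⟦ substitute σ p ⟧ ρm
  substitute-correct (op [+] p₁ p₂) r = +-cong (substitute-correct p₁ r) (substitute-correct p₂ r)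
  substitute-correct (op [*] p₁ p₂) r = *-cong (substitute-correct p₁ r) (substitute-correct p₂ r)
  substitute-correct (con c)        r = refl
  substitute-correct (var i)        r = substitution-lookup r i
  substitute-correct (p :^ k)       r = ^-congˡ k (substitute-correct p r)
  substitute-correct (:- p)         r = -‿cong (substitute-correct p r)

  close : ∀ {a} {A : Set a} n → N-ary n (Polynomial n) A → A
  close n f = f $ⁿ Vec.map var (Vec.allFin n)

  solveSubstituted : ∀ n m (f : N-ary n (Polynomial n) (Polynomial n × Polynomial n))
    (σf : N-ary m (Polynomial m) (Vec (Polynomial m) n)) (ρm : Vec Carrier m) (ρ : Vec Carrier n) →
    Substitution ρm ρ (close m σf) →
    ⟦ substitute (close m σf) (proj₁ (close n f)) ⟧↓ ρm ≈ ⟦ substitute (close m σf) (proj₂ (close n f)) ⟧↓ ρm →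
    ⟦ proj₁ (close n f) ⟧ ρ ≈ ⟦ proj₂ (close n f) ⟧ ρ
  solveSubstituted n m f σf ρm ρ r h = begin
    ⟦ lhs ⟧ ρ                  ≈⟨ substitute-correct lhs r ⟩
    ⟦ substitute σ lhs ⟧ ρm     ≈⟨ prove ρm (substitute σ lhs) (substitute σ rhs) h ⟩
    ⟦ substitute σ rhs ⟧ ρm     ≈⟨ substitute-correct rhs r ⟨
    ⟦ rhs ⟧ ρ                  ∎
    where
    lhs rhs : Polynomial n
    lhs = proj₁ (close n f)
    rhs = proj₂ (close n f)
    σ : Vec (Polynomial m) n
    σ = close m σf


-- An equation between products of atoms ρ is checked after rewriting every atom as a
-- product of base factors ρm; this lets the solver see through Pochhammer splittings.
module FactorisationSolver {c ℓ : Level} (M : CommutativeMonoid c ℓ) where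
  open CommutativeMonoid M
  open import Algebra.Solver.CommutativeMonoid M
    using (normalise; normalise-correct; var; _⊕_) renaming (Expr to Product; id to unit; ⟦_⟧ to ⟦_⟧; ⟦_⟧⇓ to ⟦_⟧⇓)
    public
  open import Data.Product using (_×_)
  open import Relation.Binary.Reasoning.Setoid setoid

  infixl 7 _●_
  _●_ : ∀ {n} → Product n → Product n → Product n
  _●_ = _⊕_

  infix 4 _≐_
  _≐_ : ∀ {n} → Product n → Product n → Product n × Product n
  _≐_ = _,_

  substitute : ∀ {n m} → Vec (Product m) n → Product n → Product m
  substitute σ (var i) = lookup σ i
  substitute σ unit    = unit
  substitute σ (a ⊕ b) = substitute σ a ⊕ substitute σ b

  data Factorisation {m} (ρm : Vec Carrier m) : ∀ {n} → Vec Carrier n → Vec (Product m) n → Set (c ⊔ ℓ) where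
    []  : Factorisation ρm [] []
    _∷_ : ∀ {n x e} {xs : Vec Carrier n} {es} →
          x ≈ ⟦ e ⟧ ρm → Factorisation ρm xs es → Factorisation ρm (x ∷ xs) (e ∷ es)

  factorisation-lookup : ∀ {n m} {ρm : Vec Carrier m} {ρ : Vec Carrier n} {σ} →
                         Factorisation ρm ρ σ → ∀ i → lookup ρ i ≈ ⟦ lookup σ i ⟧ ρm
  factorisation-lookup (p ∷ _) Fin.zero    = p
  factorisation-lookup (_ ∷ r) (Fin.suc i) = factorisation-lookup r i

  substitute-correct : ∀ {n m} (e : Product n) {σ : Vec (Product m) n} {ρm : Vec Carrier m} {ρ : Vec Carrier n} →
                       Factorisation ρm ρ σ → ⟦ e ⟧ ρ ≈ ⟦ substitute σ e ⟧ ρm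
  substitute-correct (var i) r = factorisation-lookup r i
  substitute-correct unit    r = refl
  substitute-correct (a ⊕ b) r = ∙-cong (substitute-correct a r) (substitute-correct b r)

  close : ∀ {a} {A : Set a} n → N-ary n (Product n) A → A
  close n f = f $ⁿ Vec.map var (Vec.allFin n)

  solveFactorised : ∀ n m (f : N-ary n (Product n) (Product n × Product n))
    (σf : N-ary m (Product m) (Vec (Product m) n)) (ρm : Vec Carrier m) (ρ : Vec Carrier n) →
    Factorisation ρm ρ (close m σf) →
    ⟦ normalise (substitute (close m σf) (proj₁ (close n f))) ⟧⇓ ρm
      ≈ ⟦ normalise (substitute (close m σf) (proj₂ (close n f))) ⟧⇓ ρm →
    ⟦ proj₁ (close n f) ⟧ ρ ≈ ⟦ proj₂ (close n f) ⟧ ρ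
  solveFactorised n m f σf ρm ρ r h = begin
    ⟦ lhs ⟧ ρ                          ≈⟨ substitute-correct lhs r ⟩
    ⟦ substitute σ lhs ⟧ ρm             ≈⟨ normalise-correct (substitute σ lhs) ρm ⟨
    ⟦ normalise (substitute σ lhs) ⟧⇓ ρm ≈⟨ h ⟩
    ⟦ normalise (substitute σ rhs) ⟧⇓ ρm ≈⟨ normalise-correct (substitute σ rhs) ρm ⟩
    ⟦ substitute σ rhs ⟧ ρm             ≈⟨ substitute-correct rhs r ⟨
    ⟦ rhs ⟧ ρ                          ∎
    where
    lhs rhs : Product n
    lhs = proj₁ (close n f)
    rhs = proj₂ (close n f)
    σ : Vec (Product m) n
    σ = close m σf

module FieldProperties {c ℓ : Level} (F : Field c ℓ) where
  open QSeries F
  open import Relation.Binary.Reasoning.Setoid setoid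
  open import Algebra.Properties.CommutativeSemigroup *-commutativeSemigroup using (interchange)

  ≉0-cong : ∀ {x y} → x ≈ y → x ≉0 → y ≉0
  ≉0-cong x≈y x≉0 y≈0 = x≉0 (trans x≈y y≈0)

  1≉0 : 1# ≉0
  1≉0 1≈0 = 0≉1 (sym 1≈0)

  ⁻¹-inverseʳ : ∀ {x} → x ≉0 → x * x ⁻¹ ≈ 1#
  ⁻¹-inverseʳ {x} = ⁻¹-inverse x

  ⁻¹-inverseˡ : ∀ {x} → x ≉0 → x ⁻¹ * x ≈ 1#
  ⁻¹-inverseˡ x≉0 = trans (*-comm _ _) (⁻¹-inverseʳ x≉0)

  *-cancelʳ : ∀ {x y z} → z ≉0 → x * z ≈ y * z → x ≈ y
  *-cancelʳ {x} {y} {z} z≉0 xz≈yz = begin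
    x                  ≈⟨ *-identityʳ x ⟨
    x * 1#             ≈⟨ *-congˡ (⁻¹-inverseʳ z≉0) ⟨
    x * (z * z ⁻¹)     ≈⟨ *-assoc _ _ _ ⟨
    (x * z) * z ⁻¹     ≈⟨ *-congʳ xz≈yz ⟩
    (y * z) * z ⁻¹     ≈⟨ *-assoc _ _ _ ⟩
    y * (z * z ⁻¹)     ≈⟨ *-congˡ (⁻¹-inverseʳ z≉0) ⟩
    y * 1#             ≈⟨ *-identityʳ y ⟩
    y                  ∎

  *-≉0 : ∀ {x y} → x ≉0 → y ≉0 → (x * y) ≉0
  *-≉0 {x} {y} x≉0 y≉0 xy≈0 = x≉0 (*-cancelʳ y≉0 (trans xy≈0 (sym (zeroˡ y))))

  ⁻¹-≉0 : ∀ {x} → x ≉0 → (x ⁻¹) ≉0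
  ⁻¹-≉0 {x} x≉0 x⁻¹≈0 = 0≉1 (begin
    0#         ≈⟨ zeroʳ x ⟨
    x * 0#     ≈⟨ *-congˡ x⁻¹≈0 ⟨
    x * x ⁻¹   ≈⟨ ⁻¹-inverseʳ x≉0 ⟩
    1#         ∎)

  ⁻¹-unique : ∀ {x y} → x ≉0 → x * y ≈ 1# → x ⁻¹ ≈ y
  ⁻¹-unique {x} {y} x≉0 xy≈1 = *-cancelʳ x≉0 (trans (⁻¹-inverseˡ x≉0) (trans (sym xy≈1) (*-comm x y)))

  ⁻¹-involutive : ∀ {x} → x ≉0 → (x ⁻¹) ⁻¹ ≈ x
  ⁻¹-involutive x≉0 = ⁻¹-unique (⁻¹-≉0 x≉0) (⁻¹-inverseˡ x≉0)

  ⁻¹-distrib-* : ∀ {x y} → x ≉0 → y ≉0 → (x * y) ⁻¹ ≈ x ⁻¹ * y ⁻¹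
  ⁻¹-distrib-* {x} {y} x≉0 y≉0 = ⁻¹-unique (*-≉0 x≉0 y≉0) (begin
    (x * y) * (x ⁻¹ * y ⁻¹)     ≈⟨ interchange x y (x ⁻¹) (y ⁻¹) ⟩
    (x * x ⁻¹) * (y * y ⁻¹)     ≈⟨ *-cong (⁻¹-inverseʳ x≉0) (⁻¹-inverseʳ y≉0) ⟩
    1# * 1#                     ≈⟨ *-identityˡ 1# ⟩
    1#                          ∎)

  *₃-≉0 : ∀ {x y z} → x ≉0 → y ≉0 → z ≉0 → (x * y * z) ≉0
  *₃-≉0 x≉0 y≉0 z≉0 = *-≉0 (*-≉0 x≉0 y≉0) z≉0

  *₄-≉0 : ∀ {x y z w} → x ≉0 → y ≉0 → z ≉0 → w ≉0 → (x * y * z * w) ≉0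
  *₄-≉0 x≉0 y≉0 z≉0 w≉0 = *-≉0 (*₃-≉0 x≉0 y≉0 z≉0) w≉0

  *₅-≉0 : ∀ {x y z w v} → x ≉0 → y ≉0 → z ≉0 → w ≉0 → v ≉0 → (x * y * z * w * v) ≉0
  *₅-≉0 x≉0 y≉0 z≉0 w≉0 v≉0 = *-≉0 (*₄-≉0 x≉0 y≉0 z≉0 w≉0) v≉0

  ⁻¹-distrib-*₃ : ∀ {x y z} → x ≉0 → y ≉0 → z ≉0 → (x * y * z) ⁻¹ ≈ x ⁻¹ * y ⁻¹ * z ⁻¹
  ⁻¹-distrib-*₃ x≉0 y≉0 z≉0 = trans (⁻¹-distrib-* (*-≉0 x≉0 y≉0) z≉0) (*-congʳ (⁻¹-distrib-* x≉0 y≉0))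

  ⁻¹-distrib-*₄ : ∀ {x y z w} → x ≉0 → y ≉0 → z ≉0 → w ≉0 → (x * y * z * w) ⁻¹ ≈ x ⁻¹ * y ⁻¹ * z ⁻¹ * w ⁻¹
  ⁻¹-distrib-*₄ x≉0 y≉0 z≉0 w≉0 = trans (⁻¹-distrib-* (*₃-≉0 x≉0 y≉0 z≉0) w≉0) (*-congʳ (⁻¹-distrib-*₃ x≉0 y≉0 z≉0))

  ⁻¹-distrib-*₅ : ∀ {x y z w v} → x ≉0 → y ≉0 → z ≉0 → w ≉0 → v ≉0 →
                  (x * y * z * w * v) ⁻¹ ≈ x ⁻¹ * y ⁻¹ * z ⁻¹ * w ⁻¹ * v ⁻¹
  ⁻¹-distrib-*₅ x≉0 y≉0 z≉0 w≉0 v≉0 =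
    trans (⁻¹-distrib-* (*₄-≉0 x≉0 y≉0 z≉0 w≉0) v≉0) (*-congʳ (⁻¹-distrib-*₄ x≉0 y≉0 z≉0 w≉0))

  1⁻¹≈1 : 1# ⁻¹ ≈ 1#
  1⁻¹≈1 = ⁻¹-unique 1≉0 (*-identityˡ 1#)

  /-*-/ : ∀ {x y z w} → y ≉0 → w ≉0 → (x / y) * (z / w) ≈ (x * z) / (y * w)
  /-*-/ {x} {y} {z} {w} y≉0 w≉0 = begin
    (x * y ⁻¹) * (z * w ⁻¹)     ≈⟨ interchange x (y ⁻¹) z (w ⁻¹) ⟩
    (x * z) * (y ⁻¹ * w ⁻¹)     ≈⟨ *-congˡ (⁻¹-distrib-* y≉0 w≉0) ⟨
    (x * z) * (y * w) ⁻¹        ∎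

  /-self : ∀ {x y} → x ≈ y → y ≉0 → x / y ≈ 1#
  /-self x≈y y≉0 = trans (*-congʳ x≈y) (⁻¹-inverseʳ y≉0)

  x/y*[z/w*v]≈xzv/yw : ∀ {x y z w v} → y ≉0 → w ≉0 → (x / y) * ((z / w) * v) ≈ (x * z * v) / (y * w)
  x/y*[z/w*v]≈xzv/yw {x} {y} {z} {w} {v} y≉0 w≉0 = begin
    (x / y) * ((z / w) * v)       ≈⟨ *-assoc _ _ _ ⟨
    ((x / y) * (z / w)) * v       ≈⟨ *-congʳ (/-*-/ y≉0 w≉0) ⟩
    ((x * z) / (y * w)) * v       ≈⟨ *-assoc _ _ _ ⟩
    (x * z) * ((y * w) ⁻¹ * v)    ≈⟨ *-congˡ (*-comm _ _) ⟩
    (x * z) * (v * (y * w) ⁻¹)    ≈⟨ *-assoc _ _ _ ⟨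
    (x * z * v) / (y * w)         ∎

  v*[x/y*z/w]≈vxz/yw : ∀ {v x y z w} → y ≉0 → w ≉0 → v * ((x / y) * (z / w)) ≈ (v * x * z) / (y * w)
  v*[x/y*z/w]≈vxz/yw {v} {x} {y} {z} {w} y≉0 w≉0 = begin
    v * ((x / y) * (z / w))       ≈⟨ *-congˡ (/-*-/ y≉0 w≉0) ⟩
    v * ((x * z) / (y * w))       ≈⟨ *-assoc _ _ _ ⟨
    (v * (x * z)) / (y * w)       ≈⟨ *-congʳ (*-assoc _ _ _) ⟨
    (v * x * z) / (y * w)         ∎

  /-*-cancel : ∀ {x y} → y ≉0 → (x / y) * y ≈ x
  /-*-cancel {x} {y} y≉0 = trans (*-assoc x (y ⁻¹) y) (trans (*-congˡ (⁻¹-inverseˡ y≉0)) (*-identityʳ x))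

  /-*-cancelˡ : ∀ {x y w} → y ≉0 → (x / y) * (y * w) ≈ x * w
  /-*-cancelˡ {x} {y} {w} y≉0 = trans (sym (*-assoc (x / y) y w)) (*-congʳ (/-*-cancel y≉0))

  /-*-cancelʳ : ∀ {x y w} → w ≉0 → (x / w) * (y * w) ≈ x * y
  /-*-cancelʳ {x} {y} {w} w≉0 = trans (*-congˡ (*-comm y w)) (/-*-cancelˡ w≉0)

  /-+-/ : ∀ {x y z w} → y ≉0 → w ≉0 → x / y + z / w ≈ (x * w + z * y) / (y * w)
  /-+-/ {x} {y} {z} {w} y≉0 w≉0 = *-cancelʳ (*-≉0 y≉0 w≉0) (begin
    (x / y + z / w) * (y * w)                 ≈⟨ distribʳ _ _ _ ⟩
    (x / y) * (y * w) + (z / w) * (y * w)     ≈⟨ +-cong (/-*-cancelˡ y≉0) (/-*-cancelʳ w≉0) ⟩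
    x * w + z * y                             ≈⟨ /-*-cancel (*-≉0 y≉0 w≉0) ⟨
    ((x * w + z * y) / (y * w)) * (y * w)     ∎)

  cross⇒/≈/ : ∀ {x y z w} → y ≉0 → w ≉0 → x * w ≈ z * y → x / y ≈ z / w
  cross⇒/≈/ {x} {y} {z} {w} y≉0 w≉0 xw≈zy = *-cancelʳ (*-≉0 y≉0 w≉0) (begin
    (x / y) * (y * w)     ≈⟨ /-*-cancelˡ y≉0 ⟩
    x * w                 ≈⟨ xw≈zy ⟩
    z * y                 ≈⟨ /-*-cancelʳ w≉0 ⟨
    (z / w) * (y * w)     ∎)

module PochhammerProperties {c ℓ : Level} (F : Field c ℓ) where
  open QSeries F
  open FieldProperties F using (≉0-cong)
  open IntegerRingSolver commutativeRing using (solve; _:=_; _:+_; _:-_; _:*_; :-_; con)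
  open import Relation.Binary.Reasoning.Setoid setoid
  open import Algebra.Properties.CommutativeSemigroup *-commutativeSemigroup using (interchange)

  x≈0⇒x*y≈0 : ∀ {x y} → x ≈ 0# → x * y ≈ 0#
  x≈0⇒x*y≈0 x≈0 = trans (*-congʳ x≈0) (zeroˡ _)

  y≈0⇒x*y≈0 : ∀ {x y} → y ≈ 0# → x * y ≈ 0#
  y≈0⇒x*y≈0 y≈0 = trans (*-congˡ y≈0) (zeroʳ _)

  ^-congʳ : ∀ x {m n} → m PE.≡ n → x ^ m ≈ x ^ n
  ^-congʳ x m≡n = reflexive (PE.cong (x ^_) m≡n)

  ^-congˡ : ∀ {x y} n → x ≈ y → x ^ n ≈ y ^ n
  ^-congˡ zero    x≈y = refl
  ^-congˡ (suc n) x≈y = *-cong x≈y (^-congˡ n x≈y)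

  ^-homo-* : ∀ x m n → x ^ (m +ℕ n) ≈ x ^ m * x ^ n
  ^-homo-* x zero    n = sym (*-identityˡ _)
  ^-homo-* x (suc m) n = trans (*-congˡ (^-homo-* x m n)) (sym (*-assoc _ _ _))

  ^-distrib-* : ∀ x y n → (x * y) ^ n ≈ x ^ n * y ^ n
  ^-distrib-* x y zero    = sym (*-identityˡ _)
  ^-distrib-* x y (suc n) = trans (*-congˡ (^-distrib-* x y n)) (interchange _ _ _ _)

  1^n≈1 : ∀ n → 1# ^ n ≈ 1#
  1^n≈1 zero    = refl
  1^n≈1 (suc n) = trans (*-identityˡ _) (1^n≈1 n)

  x⁻¹^n*x^n≈1 : ∀ {x} n → x ≉0 → (x ⁻¹) ^ n * x ^ n ≈ 1#
  x⁻¹^n*x^n≈1 {x} n x≉0 = begin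
    (x ⁻¹) ^ n * x ^ n    ≈⟨ ^-distrib-* _ _ n ⟨
    (x ⁻¹ * x) ^ n        ≈⟨ ^-congˡ n (trans (*-comm _ _) (⁻¹-inverse x x≉0)) ⟩
    1# ^ n                ≈⟨ 1^n≈1 n ⟩
    1#                    ∎

  x^[2n]≈[x*x]^n : ∀ x n → x ^ (2 *ℕ n) ≈ (x * x) ^ n
  x^[2n]≈[x*x]^n x n = begin
    x ^ (2 *ℕ n)       ≈⟨ ^-congʳ x (PE.cong (n +ℕ_) (ℕP.+-identityʳ n)) ⟩
    x ^ (n +ℕ n)       ≈⟨ ^-homo-* x n n ⟩
    x ^ n * x ^ n      ≈⟨ ^-distrib-* x x n ⟨
    (x * x) ^ n        ∎

  poch-congˡ : ∀ {x y} q n → x ≈ y → poch x q n ≈ poch y q n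
  poch-congˡ q zero    x≈y = refl
  poch-congˡ q (suc n) x≈y = *-cong (poch-congˡ q n x≈y) (+-congˡ (-‿cong (*-congʳ x≈y)))

  poch-congʳ : ∀ x q {m n} → m PE.≡ n → poch x q m ≈ poch x q n
  poch-congʳ x q m≡n = reflexive (PE.cong (poch x q) m≡n)

  poch-+ : ∀ x q m n → poch x q (m +ℕ n) ≈ poch x q m * poch (x * q ^ m) q n
  poch-+ x q m zero = trans (poch-congʳ x q (ℕP.+-identityʳ m)) (sym (*-identityʳ _))
  poch-+ x q m (suc n) = begin
    poch x q (m +ℕ suc n)                                   ≈⟨ poch-congʳ x q (ℕP.+-suc m n) ⟩
    poch x q (m +ℕ n) * (1# − x * q ^ (m +ℕ n))             ≈⟨ *-cong (poch-+ x q m n) (+-congˡ (-‿cong x*q^[m+n])) ⟩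
    (poch x q m * poch (x * q ^ m) q n) * (1# − x * q ^ m * q ^ n) ≈⟨ *-assoc _ _ _ ⟩
    poch x q m * poch (x * q ^ m) q (suc n)                 ∎
    where
    x*q^[m+n] : x * q ^ (m +ℕ n) ≈ x * q ^ m * q ^ n
    x*q^[m+n] = trans (*-congˡ (^-homo-* q m n)) (sym (*-assoc _ _ _))

  poch-unfoldˡ : ∀ x q n → poch x q (suc n) ≈ (1# − x) * poch (x * q) q n
  poch-unfoldˡ x q zero = begin
    1# * (1# − x * 1#)     ≈⟨ *-identityˡ _ ⟩
    1# − x * 1#            ≈⟨ +-congˡ (-‿cong (*-identityʳ x)) ⟩
    1# − x                 ≈⟨ *-identityʳ _ ⟨
    (1# − x) * 1#          ∎
  poch-unfoldˡ x q (suc n) = begin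
    poch x q (suc n) * (1# − x * (q * q ^ n))              ≈⟨ *-cong (poch-unfoldˡ x q n) (+-congˡ (-‿cong (sym (*-assoc _ _ _)))) ⟩
    ((1# − x) * poch (x * q) q n) * (1# − x * q * q ^ n)   ≈⟨ *-assoc _ _ _ ⟩
    (1# − x) * poch (x * q) q (suc n)                      ∎

  dualPoch : Carrier → Carrier → ℕ → Carrier
  dualPoch t q zero    = 1#
  dualPoch t q (suc n) = dualPoch t q n * (t − q ^ n)

  dualPoch≈poch : ∀ {x t} q → x * t ≈ 1# → ∀ n → dualPoch t q n ≈ poch x q n * t ^ n
  dualPoch≈poch         q xt≈1 zero    = sym (*-identityˡ 1#)
  dualPoch≈poch {x} {t} q xt≈1 (suc n) = begin
    dualPoch t q n * (t − q ^ n)                       ≈⟨ *-cong (dualPoch≈poch q xt≈1 n) factor ⟩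
    (poch x q n * t ^ n) * ((1# − x * q ^ n) * t)      ≈⟨ interchange _ _ _ _ ⟩
    (poch x q n * (1# − x * q ^ n)) * (t ^ n * t)      ≈⟨ *-congˡ (*-comm _ _) ⟩
    poch x q (suc n) * t ^ suc n                       ∎
    where
    factor : t − q ^ n ≈ (1# − x * q ^ n) * t
    factor = begin
      t − q ^ n                  ≈⟨ +-congˡ (-‿cong (trans (*-congʳ xt≈1) (*-identityˡ _))) ⟨
      t − (x * t) * q ^ n        ≈⟨ solve 3 (λ t x Q → t :- (x :* t) :* Q := (con (+ 1) :- x :* Q) :* t) refl t x (q ^ n) ⟩
      (1# − x * q ^ n) * t       ∎

  reversalFactor : Carrier → Carrier → ℕ → ℕ → Carrier
  reversalFactor b x s zero    = 1#
  reversalFactor b x s (suc r) = reversalFactor b x (suc s) r * (- (x * b ^ s))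

  poch-reverse : ∀ {b x} → b ≉0 → x ≉0 → ∀ r s →
                 poch (x * b ^ s) b r ≈ poch (x ⁻¹ * b * (b ⁻¹) ^ (s +ℕ r)) b r * reversalFactor b x s r
  poch-reverse         b≉0 x≉0 zero    s = sym (*-identityʳ _)
  poch-reverse {b} {x} b≉0 x≉0 (suc r) s = begin
    poch (x * b ^ s) b (suc r)                            ≈⟨ poch-unfoldˡ (x * b ^ s) b r ⟩
    (1# − x * b ^ s) * poch (x * b ^ s * b) b r           ≈⟨ *-congˡ (poch-congˡ b r (trans (*-assoc _ _ _) (*-congˡ (*-comm _ _)))) ⟩
    (1# − x * b ^ s) * poch (x * b ^ suc s) b r           ≈⟨ *-cong reverse-factor (poch-reverse b≉0 x≉0 r (suc s)) ⟩
    ((1# − y * b ^ r) * (- (x * b ^ s))) * (poch (x ⁻¹ * b * (b ⁻¹) ^ (suc s +ℕ r)) b r * reversalFactor b x (suc s) r)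
      ≈⟨ *-congˡ (*-congʳ (poch-congˡ b r (*-congˡ (^-congʳ (b ⁻¹) (PE.sym (ℕP.+-suc s r)))))) ⟩
    ((1# − y * b ^ r) * (- (x * b ^ s))) * (poch y b r * reversalFactor b x (suc s) r)
      ≈⟨ interchange _ _ _ _ ⟩
    ((1# − y * b ^ r) * poch y b r) * ((- (x * b ^ s)) * reversalFactor b x (suc s) r)
      ≈⟨ *-cong (*-comm _ _) (*-comm _ _) ⟩
    poch y b (suc r) * reversalFactor b x s (suc r)       ∎
    where
    y : Carrier
    y = x ⁻¹ * b * (b ⁻¹) ^ (s +ℕ suc r)

    b*bˢ*bʳ : b * b ^ s * b ^ r ≈ b ^ (s +ℕ suc r)
    b*bˢ*bʳ = begin
      b * b ^ s * b ^ r       ≈⟨ *-assoc _ _ _ ⟩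
      b * (b ^ s * b ^ r)     ≈⟨ *-congˡ (^-homo-* b s r) ⟨
      b ^ suc (s +ℕ r)        ≈⟨ ^-congʳ b (PE.sym (ℕP.+-suc s r)) ⟩
      b ^ (s +ℕ suc r)        ∎

    reverse-factor : 1# − x * b ^ s ≈ (1# − y * b ^ r) * (- (x * b ^ s))
    reverse-factor = sym (begin
      (1# − y * b ^ r) * (- (x * b ^ s))
        ≈⟨ solve 6 (λ x x⁻¹ b B bˢ bʳ → (con (+ 1) :- x⁻¹ :* b :* B :* bʳ) :* (:- (x :* bˢ))
                       := :- (x :* bˢ) :+ (x :* x⁻¹) :* (B :* (b :* bˢ :* bʳ))) refl x (x ⁻¹) b ((b ⁻¹) ^ (s +ℕ suc r)) (b ^ s) (b ^ r) ⟩
      - (x * b ^ s) + (x * x ⁻¹) * ((b ⁻¹) ^ (s +ℕ suc r) * (b * b ^ s * b ^ r))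
        ≈⟨ +-congˡ (*-cong (⁻¹-inverse x x≉0) (*-congˡ b*bˢ*bʳ)) ⟩
      - (x * b ^ s) + 1# * ((b ⁻¹) ^ (s +ℕ suc r) * b ^ (s +ℕ suc r))
        ≈⟨ +-congˡ (trans (*-identityˡ _) (x⁻¹^n*x^n≈1 (s +ℕ suc r) b≉0)) ⟩
      - (x * b ^ s) + 1#
        ≈⟨ +-comm _ _ ⟩
      1# − x * b ^ s ∎)

  poch-≉0-≤ : ∀ {x q m n} → m ≤ n → poch x q n ≉0 → poch x q m ≉0
  poch-≉0-≤ {x} {q} {m} {n} m≤n pochₙ≉0 pochₘ≈0 = pochₙ≉0 (begin
    poch x q n                                ≈⟨ poch-congʳ x q (PE.sym (ℕP.m+[n∸m]≡n m≤n)) ⟩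
    poch x q (m +ℕ (n ∸ m))                   ≈⟨ poch-+ x q m (n ∸ m) ⟩
    poch x q m * poch (x * q ^ m) q (n ∸ m)   ≈⟨ x≈0⇒x*y≈0 pochₘ≈0 ⟩
    0#                                        ∎)

  poch-factor-≉0 : ∀ {x q k n} → k < n → poch x q n ≉0 → (1# − x * q ^ k) ≉0
  poch-factor-≉0 k<n pochₙ≉0 = poch-≉0-≤ k<n pochₙ≉0 ∘ y≈0⇒x*y≈0

  1−‿cong : ∀ {x y} → x ≈ y → 1# − x ≈ 1# − y
  1−‿cong x≈y = +-congˡ (-‿cong x≈y)

  powers : Carrier → List ℕ → Carrier
  powers q []       = 1#
  powers q (k ∷ ks) = q ^ k * powers q ks

  ^-sum : ∀ q {n} ks → n PE.≡ sum ks → q ^ n ≈ powers q ks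
  ^-sum q []       n≡0   = ^-congʳ q n≡0
  ^-sum q (k ∷ ks) n≡sum = trans (^-congʳ q n≡sum) (trans (^-homo-* q k (sum ks)) (*-congˡ (^-sum q ks PE.refl)))

  poch-last-factor-≉0 : ∀ x q k → poch x q (suc k) ≉0 → (1# − x * q ^ k) ≉0
  poch-last-factor-≉0 x q k = poch-factor-≉0 {x} {q} {k} {suc k} ℕP.≤-refl

  poch-shifted-factor-≉0 : ∀ x q {n} k → n PE.≡ suc k → poch (x * q) q (suc k) ≉0 → (1# − x * q ^ n) ≉0
  poch-shifted-factor-≉0 x q k n≡1+k pochₖ≉0 =
    ≉0-cong (1−‿cong (trans (*-assoc x q (q ^ k)) (*-congˡ (^-congʳ q (PE.sym n≡1+k)))))
            (poch-last-factor-≉0 (x * q) q k pochₖ≉0)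

module SumProperties {c ℓ : Level} (F : Field c ℓ) where
  open QSeries F
  open import Relation.Binary.Reasoning.Setoid setoid
  open import Algebra.Properties.CommutativeSemigroup +-commutativeSemigroup using (interchange)

  Σ≤-cong-≤ : ∀ n {f g : ℕ → Carrier} → (∀ i → i ≤ n → f i ≈ g i) → Σ≤ n f ≈ Σ≤ n g
  Σ≤-cong-≤ zero    f≈g = f≈g 0 z≤n
  Σ≤-cong-≤ (suc n) f≈g = +-cong (Σ≤-cong-≤ n (λ i i≤n → f≈g i (ℕP.m≤n⇒m≤1+n i≤n))) (f≈g (suc n) ℕP.≤-refl)

  Σ≤-cong : ∀ n {f g : ℕ → Carrier} → (∀ i → f i ≈ g i) → Σ≤ n f ≈ Σ≤ n g
  Σ≤-cong n f≈g = Σ≤-cong-≤ n (λ i _ → f≈g i)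

  *-distribˡ-Σ≤ : ∀ n x (f : ℕ → Carrier) → x * Σ≤ n f ≈ Σ≤ n (λ i → x * f i)
  *-distribˡ-Σ≤ zero    x f = refl
  *-distribˡ-Σ≤ (suc n) x f = trans (distribˡ _ _ _) (+-congʳ (*-distribˡ-Σ≤ n x f))

  *-distribʳ-Σ≤ : ∀ n x (f : ℕ → Carrier) → Σ≤ n f * x ≈ Σ≤ n (λ i → f i * x)
  *-distribʳ-Σ≤ zero    x f = refl
  *-distribʳ-Σ≤ (suc n) x f = trans (distribʳ _ _ _) (+-congʳ (*-distribʳ-Σ≤ n x f))

  Σ≤-distrib-+ : ∀ n (f g : ℕ → Carrier) → Σ≤ n (λ i → f i + g i) ≈ Σ≤ n f + Σ≤ n g
  Σ≤-distrib-+ zero    f g = refl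
  Σ≤-distrib-+ (suc n) f g = trans (+-congʳ (Σ≤-distrib-+ n f g)) (interchange _ _ _ _)

  Σ≤-zero : ∀ n {f : ℕ → Carrier} → (∀ i → i ≤ n → f i ≈ 0#) → Σ≤ n f ≈ 0#
  Σ≤-zero n {f} f≈0 = trans (Σ≤-cong-≤ n f≈0) (Σ≤-0 n)
    where
    Σ≤-0 : ∀ n → Σ≤ n (λ _ → 0#) ≈ 0#
    Σ≤-0 zero    = refl
    Σ≤-0 (suc n) = trans (+-identityʳ _) (Σ≤-0 n)

  Σ≤-last : ∀ n {f : ℕ → Carrier} → (∀ i → i < n → f i ≈ 0#) → Σ≤ n f ≈ f n
  Σ≤-last zero    _   = refl
  Σ≤-last (suc n) f≈0 = trans (+-congʳ (Σ≤-zero n (λ i i≤n → f≈0 i (s≤s i≤n)))) (+-identityˡ _)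

  Σ≤-Σ≤-exchange : ∀ m (h : ℕ → ℕ → Carrier) →
    Σ≤ m (λ j → Σ≤ j (h j)) ≈ Σ≤ m (λ i → Σ≤ (m ∸ i) (λ s → h (i +ℕ s) i))
  Σ≤-Σ≤-exchange zero    h = refl
  Σ≤-Σ≤-exchange (suc m) h = begin
    Σ≤ m (λ j → Σ≤ j (h j)) + (Σ≤ m (h (suc m)) + h (suc m) (suc m))
      ≈⟨ +-congʳ (Σ≤-Σ≤-exchange m h) ⟩
    Σ≤ m (λ i → Σ≤ (m ∸ i) (column i)) + (Σ≤ m (h (suc m)) + h (suc m) (suc m))
      ≈⟨ +-assoc _ _ _ ⟨
    (Σ≤ m (λ i → Σ≤ (m ∸ i) (column i)) + Σ≤ m (h (suc m))) + h (suc m) (suc m)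
      ≈⟨ +-cong (Σ≤-distrib-+ m _ _) last-column ⟨
    Σ≤ m (λ i → Σ≤ (m ∸ i) (column i) + h (suc m) i) + Σ≤ (suc m ∸ suc m) (column (suc m))
      ≈⟨ +-congʳ (Σ≤-cong-≤ m extend-column) ⟩
    Σ≤ m (λ i → Σ≤ (suc m ∸ i) (column i)) + Σ≤ (suc m ∸ suc m) (column (suc m)) ∎
    where
    column : ℕ → ℕ → Carrier
    column i s = h (i +ℕ s) i

    last-column : Σ≤ (suc m ∸ suc m) (column (suc m)) ≈ h (suc m) (suc m)
    last-column = reflexive (PE.trans (PE.cong (λ k → Σ≤ k (column (suc m))) (ℕP.n∸n≡0 m))
                                      (PE.cong (λ k → h k (suc m)) (ℕP.+-identityʳ (suc m))))

    extend-column : ∀ i → i ≤ m → Σ≤ (m ∸ i) (column i) + h (suc m) i ≈ Σ≤ (suc m ∸ i) (column i)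
    extend-column i i≤m = begin
      Σ≤ (m ∸ i) (column i) + h (suc m) i         ≡⟨ PE.cong (λ k → Σ≤ (m ∸ i) (column i) + h k i) suc-m≡ ⟩
      Σ≤ (suc (m ∸ i)) (column i)                  ≡⟨ PE.cong (λ k → Σ≤ k (column i)) (PE.sym (ℕP.+-∸-assoc 1 i≤m)) ⟩
      Σ≤ (suc m ∸ i) (column i)                    ∎
      where
      suc-m≡ : suc m PE.≡ i +ℕ suc (m ∸ i)
      suc-m≡ = PE.trans (PE.sym (ℕP.m+[n∸m]≡n (ℕP.m≤n⇒m≤1+n i≤m))) (PE.cong (i +ℕ_) (ℕP.+-∸-assoc 1 i≤m))

module BaileyPairs {c ℓ : Level} (F : Field c ℓ) where
  open QSeries F
  open FieldProperties F
  open PochhammerProperties F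
  open SumProperties F
  open IntegerRingSolver commutativeRing
  open FactorisationSolver *-commutativeMonoid
  open import Relation.Binary.Reasoning.Setoid setoid

  module InverseKernel (E C q : Carrier) (E≉0 : E ≉0) (1−C≉0 : (1# − C) ≉0) (1−Eq²ʲ≉0 : ∀ j → (1# − E * q ^ (2 *ℕ j)) ≉0)
    (poch-q≉0 : ∀ m → poch q q m ≉0) (poch-Eq≉0 : ∀ m → poch (E * q) q m ≉0) (poch-Cq≉0 : ∀ m → poch (C * q) q m ≉0)
    where

    t : Carrier
    t = C / E

    K : ℕ → ℕ → Carrier
    K j i = kernel E C q j i

    -- dualPoch t q (m ∸ j) is (E/C; q)_{m−j} (C/E)^{m−j}, see dualPoch≈poch.
    inverseKernel : ℕ → ℕ → Carrier
    inverseKernel m j = ((1# − E * q ^ (2 *ℕ m)) * (1# − C * q ^ (2 *ℕ j)) * dualPoch t q (m ∸ j) * poch E q (m +ℕ j))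
             / ((1# − E) * (1# − C) * poch q q (m ∸ j) * poch (C * q) q (m +ℕ j))

    -- closedForm m i s u is the value of partialSum m i s when m = i + s + u + 1: each
    -- ClosedFormStep adds one term, and ClosedFormLast shows that the final term cancels it.
    closedFormScale : ℕ → ℕ → Carrier
    closedFormScale m i = (1# − E * q ^ (2 *ℕ m)) / ((1# − E) * (1# − C) * (1# − E * q ^ (m +ℕ i)) * (1# − q ^ (m ∸ i)))

    closedForm : ℕ → ℕ → ℕ → ℕ → Carrier
    closedForm m i s u = closedFormScale m i
      * ((dualPoch t q (suc u) * poch E q (2 *ℕ i +ℕ 2 *ℕ s +ℕ u +ℕ 2) * poch (t * q) q s * poch C q (2 *ℕ i +ℕ s +ℕ 1))
                        / (poch q q u * poch (C * q) q (2 *ℕ i +ℕ 2 *ℕ s +ℕ u +ℕ 1) * poch q q s * poch (E * q) q (2 *ℕ i +ℕ s)))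

    polyProduct : ∀ {n} → List (Polynomial n) → Polynomial n
    polyProduct [] = con (+ 1)
    polyProduct (x ∷ xs) = x :* polyProduct xs

    C≈tE : C ≈ t * E
    C≈tE = sym (begin
      (C * E ⁻¹) * E ≈⟨ *-assoc _ _ _ ⟩
      C * (E ⁻¹ * E) ≈⟨ *-congˡ (⁻¹-inverseˡ E≉0) ⟩
      C * 1# ≈⟨ *-identityʳ C ⟩
      C ∎)

    1−E≉0 : (1# − E) ≉0
    1−E≉0 = ≉0-cong (1−‿cong (*-identityʳ E)) (1−Eq²ʲ≉0 0)

    module ClosedFormStep (i s u : ℕ) where
      m j L2 L3 L4 LB : ℕ
      m = i +ℕ s +ℕ u +ℕ 2
      j = i +ℕ suc s
      L2 = 2 *ℕ i +ℕ 2 *ℕ s +ℕ suc u +ℕ 1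
      L3 = 2 *ℕ i +ℕ s +ℕ 1
      L4 = 2 *ℕ i +ℕ s
      LB = 2 *ℕ i +ℕ 2 *ℕ s +ℕ suc u +ℕ 2

      b0 bE bC bk1 bk2 f1 g1 g2 g3 g4 n1 n2 e1 e2 e3 : Carrier
      b0 = 1# − E * q ^ (2 *ℕ m)
      bE = 1# − E
      bC = 1# − C
      bk1 = 1# − E * q ^ (m +ℕ i)
      bk2 = 1# − q ^ (m ∸ i)
      f1 = t − q ^ suc u
      g1 = 1# − q * q ^ u
      g2 = 1# − C * q * q ^ L2
      g3 = 1# − q * q ^ s
      g4 = 1# − E * q * q ^ L4
      n1 = 1# − C * q ^ (2 *ℕ j)
      n2 = 1# − t
      e1 = 1# − E * q ^ LB
      e2 = 1# − t * q * q ^ s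
      e3 = 1# − C * q ^ L3

      eqL2 : L2 PE.≡ sum (2 *ℕ i ∷ s ∷ s ∷ u ∷ 1 ∷ 1 ∷ [])
      eqL2 = eqL2′ i s u where
        eqL2′ : ∀ i s u → 2 *ℕ i +ℕ 2 *ℕ s +ℕ suc u +ℕ 1 PE.≡ 2 *ℕ i +ℕ (s +ℕ (s +ℕ (u +ℕ (1 +ℕ (1 +ℕ 0)))))
        eqL2′ = solve-∀
      eqL4 : L4 PE.≡ sum (2 *ℕ i ∷ s ∷ [])
      eqL4 = eqL4′ i s where
        eqL4′ : ∀ i s → 2 *ℕ i +ℕ s PE.≡ 2 *ℕ i +ℕ (s +ℕ 0)
        eqL4′ = solve-∀
      eqj : 2 *ℕ j PE.≡ sum (2 *ℕ i ∷ s ∷ s ∷ 1 ∷ 1 ∷ [])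
      eqj = eqj′ i s where
        eqj′ : ∀ i s → 2 *ℕ (i +ℕ suc s) PE.≡ 2 *ℕ i +ℕ (s +ℕ (s +ℕ (1 +ℕ (1 +ℕ 0))))
        eqj′ = solve-∀
      eqmi : m +ℕ i PE.≡ sum (2 *ℕ i ∷ s ∷ u ∷ 1 ∷ 1 ∷ [])
      eqmi = eqmi′ i s u where
        eqmi′ : ∀ i s u → i +ℕ s +ℕ u +ℕ 2 +ℕ i PE.≡ 2 *ℕ i +ℕ (s +ℕ (u +ℕ (1 +ℕ (1 +ℕ 0))))
        eqmi′ = solve-∀
      eqm∸i : m ∸ i PE.≡ sum (s ∷ u ∷ 1 ∷ 1 ∷ [])
      eqm∸i = PE.trans (PE.cong (_∸ i) (m≡i+[s+u+2] i s u)) (ℕP.m+n∸m≡n i _) where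
        m≡i+[s+u+2] : ∀ i s u → i +ℕ s +ℕ u +ℕ 2 PE.≡ i +ℕ (s +ℕ (u +ℕ (1 +ℕ (1 +ℕ 0))))
        m≡i+[s+u+2] = solve-∀
      eqLB : LB PE.≡ sum (2 *ℕ i ∷ s ∷ s ∷ u ∷ 1 ∷ 1 ∷ 1 ∷ [])
      eqLB = eqLB′ i s u where
        eqLB′ : ∀ i s u → 2 *ℕ i +ℕ 2 *ℕ s +ℕ suc u +ℕ 2 PE.≡ 2 *ℕ i +ℕ (s +ℕ (s +ℕ (u +ℕ (1 +ℕ (1 +ℕ (1 +ℕ 0))))))
        eqLB′ = solve-∀
      eqL3 : L3 PE.≡ sum (2 *ℕ i ∷ s ∷ 1 ∷ [])
      eqL3 = eqL3′ i s where
        eqL3′ : ∀ i s → 2 *ℕ i +ℕ s +ℕ 1 PE.≡ 2 *ℕ i +ℕ (s +ℕ (1 +ℕ 0))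
        eqL3′ = solve-∀

      -- The substitution expresses each factor in t, E, q, X = q^{2i}, S = q^s and U = q^u.
      step-identity : f1 * g2 * g3 * g4 + n1 * n2 * bk1 * bk2 ≈ e1 * e2 * e3 * g1
      step-identity = solveSubstituted 12 6
        (λ f1 g1 g2 g3 g4 n1 n2 bk1 bk2 e1 e2 e3 →
           f1 :* g2 :* g3 :* g4 :+ n1 :* n2 :* bk1 :* bk2 := e1 :* e2 :* e3 :* g1)
        (λ t E q X S U → let q1 = q :* con (+ 1) ; C = t :* E ; one = con (+ 1) in
           (t :+ :- (q :* U)) ∷ (one :+ :- (q :* U))
           ∷ (one :+ :- (C :* q :* polyProduct (X ∷ S ∷ S ∷ U ∷ q1 ∷ q1 ∷ [])))
           ∷ (one :+ :- (q :* S))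
           ∷ (one :+ :- (E :* q :* polyProduct (X ∷ S ∷ [])))
           ∷ (one :+ :- (C :* polyProduct (X ∷ S ∷ S ∷ q1 ∷ q1 ∷ [])))
           ∷ (one :+ :- t)
           ∷ (one :+ :- (E :* polyProduct (X ∷ S ∷ U ∷ q1 ∷ q1 ∷ [])))
           ∷ (one :+ :- polyProduct (S ∷ U ∷ q1 ∷ q1 ∷ []))
           ∷ (one :+ :- (E :* polyProduct (X ∷ S ∷ S ∷ U ∷ q1 ∷ q1 ∷ q1 ∷ [])))
           ∷ (one :+ :- (t :* q :* S))
           ∷ (one :+ :- (C :* polyProduct (X ∷ S ∷ q1 ∷ [])))
           ∷ [])
        (t ∷ E ∷ q ∷ q ^ (2 *ℕ i) ∷ q ^ s ∷ q ^ u ∷ [])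
        (f1 ∷ g1 ∷ g2 ∷ g3 ∷ g4 ∷ n1 ∷ n2 ∷ bk1 ∷ bk2 ∷ e1 ∷ e2 ∷ e3 ∷ [])
        (refl ∷ refl
         ∷ 1−‿cong (*-cong (*-congʳ C≈tE) (^-sum q (2 *ℕ i ∷ s ∷ s ∷ u ∷ 1 ∷ 1 ∷ []) eqL2))
         ∷ refl
         ∷ 1−‿cong (*-congˡ (^-sum q (2 *ℕ i ∷ s ∷ []) eqL4))
         ∷ 1−‿cong (*-cong C≈tE (^-sum q (2 *ℕ i ∷ s ∷ s ∷ 1 ∷ 1 ∷ []) eqj))
         ∷ refl
         ∷ 1−‿cong (*-congˡ (^-sum q (2 *ℕ i ∷ s ∷ u ∷ 1 ∷ 1 ∷ []) eqmi))
         ∷ 1−‿cong (^-sum q (s ∷ u ∷ 1 ∷ 1 ∷ []) eqm∸i)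
         ∷ 1−‿cong (*-congˡ (^-sum q (2 *ℕ i ∷ s ∷ s ∷ u ∷ 1 ∷ 1 ∷ 1 ∷ []) eqLB))
         ∷ refl
         ∷ 1−‿cong (*-cong C≈tE (^-sum q (2 *ℕ i ∷ s ∷ 1 ∷ []) eqL3))
         ∷ [])
        refl

      H1 B1 A2 A3 D1 D2 D3 D4 : Carrier
      H1 = dualPoch t q (suc u)
      B1 = poch E q LB
      A2 = poch (t * q) q s
      A3 = poch C q L3
      D1 = poch q q u
      D2 = poch (C * q) q L2
      D3 = poch q q s
      D4 = poch (E * q) q L4

      iE iC iD1 iD2 iD3 iD4 : Carrier
      iE = bE ⁻¹
      iC = bC ⁻¹
      iD1 = D1 ⁻¹
      iD2 = D2 ⁻¹
      iD3 = D3 ⁻¹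
      iD4 = D4 ⁻¹

      X1 X2 X3 Π : Carrier
      X1 = bk1 * bk2 * g1
      X2 = g1 * g2 * g3 * g4
      X3 = bk1 * bk2 * g2 * g3 * g4
      Π = (b0 * H1 * B1 * A2 * A3) * (iE * iC * iD1 * iD2 * iD3 * iD4)

      e-mj : m ∸ j PE.≡ suc u
      e-mj = PE.trans (PE.cong (_∸ j) (m≡j+[1+u] i s u)) (ℕP.m+n∸m≡n j (suc u)) where
        m≡j+[1+u] : ∀ i s u → i +ℕ s +ℕ u +ℕ 2 PE.≡ (i +ℕ suc s) +ℕ suc u
        m≡j+[1+u] = solve-∀
      e-mjB : m +ℕ j PE.≡ LB
      e-mjB = e-mjB′ i s u where
        e-mjB′ : ∀ i s u → i +ℕ s +ℕ u +ℕ 2 +ℕ (i +ℕ suc s) PE.≡ 2 *ℕ i +ℕ 2 *ℕ s +ℕ suc u +ℕ 2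
        e-mjB′ = solve-∀
      e-mjC : m +ℕ j PE.≡ suc L2
      e-mjC = e-mjC′ i s u where
        e-mjC′ : ∀ i s u → i +ℕ s +ℕ u +ℕ 2 +ℕ (i +ℕ suc s) PE.≡ suc (2 *ℕ i +ℕ 2 *ℕ s +ℕ suc u +ℕ 1)
        e-mjC′ = solve-∀
      e-ji : j ∸ i PE.≡ suc s
      e-ji = ℕP.m+n∸m≡n i (suc s)
      e-jiC : j +ℕ i PE.≡ L3
      e-jiC = e-jiC′ i s where
        e-jiC′ : ∀ i s → i +ℕ suc s +ℕ i PE.≡ 2 *ℕ i +ℕ s +ℕ 1
        e-jiC′ = solve-∀
      e-jiE : j +ℕ i PE.≡ suc L4
      e-jiE = e-jiE′ i s where
        e-jiE′ : ∀ i s → i +ℕ suc s +ℕ i PE.≡ suc (2 *ℕ i +ℕ s)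
        e-jiE′ = solve-∀
      e-nextB : 2 *ℕ i +ℕ 2 *ℕ suc s +ℕ u +ℕ 2 PE.≡ suc LB
      e-nextB = e-nextB′ i s u where
        e-nextB′ : ∀ i s u → 2 *ℕ i +ℕ 2 *ℕ suc s +ℕ u +ℕ 2 PE.≡ suc (2 *ℕ i +ℕ 2 *ℕ s +ℕ suc u +ℕ 2)
        e-nextB′ = solve-∀
      e-nextC : 2 *ℕ i +ℕ suc s +ℕ 1 PE.≡ suc L3
      e-nextC = e-nextC′ i s where
        e-nextC′ : ∀ i s → 2 *ℕ i +ℕ suc s +ℕ 1 PE.≡ suc (2 *ℕ i +ℕ s +ℕ 1)
        e-nextC′ = solve-∀
      e-nextCq : 2 *ℕ i +ℕ 2 *ℕ suc s +ℕ u +ℕ 1 PE.≡ suc L2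
      e-nextCq = e-nextCq′ i s u where
        e-nextCq′ : ∀ i s u → 2 *ℕ i +ℕ 2 *ℕ suc s +ℕ u +ℕ 1 PE.≡ suc (2 *ℕ i +ℕ 2 *ℕ s +ℕ suc u +ℕ 1)
        e-nextCq′ = solve-∀
      e-nextE : 2 *ℕ i +ℕ suc s PE.≡ suc L4
      e-nextE = ℕP.+-suc (2 *ℕ i) s
      e-mi : m +ℕ i PE.≡ suc (2 *ℕ i +ℕ s +ℕ u +ℕ 1)
      e-mi = e-mi′ i s u where
        e-mi′ : ∀ i s u → i +ℕ s +ℕ u +ℕ 2 +ℕ i PE.≡ suc (2 *ℕ i +ℕ s +ℕ u +ℕ 1)
        e-mi′ = solve-∀
      e-m∸i : m ∸ i PE.≡ suc (s +ℕ u +ℕ 1)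
      e-m∸i = PE.trans eqm∸i (s+u+2≡1+[s+u+1] s u) where
        s+u+2≡1+[s+u+1] : ∀ s u → s +ℕ (u +ℕ (1 +ℕ (1 +ℕ 0))) PE.≡ suc (s +ℕ u +ℕ 1)
        s+u+2≡1+[s+u+1] = solve-∀

      bE≉0 : bE ≉0
      bE≉0 = 1−E≉0
      bk1≉0 : bk1 ≉0
      bk1≉0 = poch-shifted-factor-≉0 E q (2 *ℕ i +ℕ s +ℕ u +ℕ 1) e-mi (poch-Eq≉0 (suc (2 *ℕ i +ℕ s +ℕ u +ℕ 1)))
      bk2≉0 : bk2 ≉0
      bk2≉0 = ≉0-cong (1−‿cong (sym (^-congʳ q e-m∸i))) (poch-last-factor-≉0 q q (s +ℕ u +ℕ 1) (poch-q≉0 (suc (s +ℕ u +ℕ 1))))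
      g1≉0 : g1 ≉0
      g1≉0 = poch-last-factor-≉0 q q u (poch-q≉0 (suc u))
      g2≉0 : g2 ≉0
      g2≉0 = poch-last-factor-≉0 (C * q) q L2 (poch-Cq≉0 (suc L2))
      g3≉0 : g3 ≉0
      g3≉0 = poch-last-factor-≉0 q q s (poch-q≉0 (suc s))
      g4≉0 : g4 ≉0
      g4≉0 = poch-last-factor-≉0 (E * q) q L4 (poch-Eq≉0 (suc L4))
      D1≉0 : D1 ≉0
      D1≉0 = poch-q≉0 u
      D2≉0 : D2 ≉0
      D2≉0 = poch-Cq≉0 L2
      D3≉0 : D3 ≉0
      D3≉0 = poch-q≉0 s
      D4≉0 : D4 ≉0
      D4≉0 = poch-Eq≉0 L4
      X1≉0 : X1 ≉0
      X1≉0 = *₃-≉0 bk1≉0 bk2≉0 g1≉0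
      X2≉0 : X2 ≉0
      X2≉0 = *₄-≉0 g1≉0 g2≉0 g3≉0 g4≉0
      X3≉0 : X3 ≉0
      X3≉0 = *₅-≉0 bk1≉0 bk2≉0 g2≉0 g3≉0 g4≉0

      previous≈ : closedForm m i s (suc u) ≈ Π * (f1 / X1)
      previous≈ = solveFactorised 15 15
        (λ b0 Dκi H1 f1 B1 A2 A3 DG1i iE iC iD1 iD2 iD3 iD4 X1i →
          (b0 ● Dκi) ● (H1 ● f1 ● B1 ● A2 ● A3 ● DG1i)
            ≐ (b0 ● H1 ● B1 ● A2 ● A3 ● (iE ● iC ● iD1 ● iD2 ● iD3 ● iD4)) ● (f1 ● X1i))
        (λ b0 H1 f1 B1 A2 A3 iE iC ik1 ik2 iD1 ig1 iD2 iD3 iD4 →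
          b0 ∷ (iE ● iC ● ik1 ● ik2) ∷ H1 ∷ f1 ∷ B1 ∷ A2 ∷ A3 ∷ ((iD1 ● ig1) ● iD2 ● iD3 ● iD4)
          ∷ iE ∷ iC ∷ iD1 ∷ iD2 ∷ iD3 ∷ iD4 ∷ (ik1 ● ik2 ● ig1) ∷ [])
        (b0 ∷ H1 ∷ f1 ∷ B1 ∷ A2 ∷ A3 ∷ iE ∷ iC ∷ bk1 ⁻¹ ∷ bk2 ⁻¹ ∷ iD1 ∷ g1 ⁻¹ ∷ iD2 ∷ iD3 ∷ iD4 ∷ [])
        (b0 ∷ (bE * bC * bk1 * bk2) ⁻¹ ∷ H1 ∷ f1 ∷ B1 ∷ A2 ∷ A3 ∷ (D1 * g1 * D2 * D3 * D4) ⁻¹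
          ∷ iE ∷ iC ∷ iD1 ∷ iD2 ∷ iD3 ∷ iD4 ∷ X1 ⁻¹ ∷ [])
        (refl ∷ ⁻¹-distrib-*₄ bE≉0 1−C≉0 bk1≉0 bk2≉0 ∷ refl ∷ refl ∷ refl ∷ refl ∷ refl
         ∷ trans (⁻¹-distrib-*₄ (*-≉0 D1≉0 g1≉0) D2≉0 D3≉0 D4≉0) (*-congʳ (*-congʳ (*-congʳ (⁻¹-distrib-* D1≉0 g1≉0))))
         ∷ refl ∷ refl ∷ refl ∷ refl ∷ refl ∷ refl ∷ ⁻¹-distrib-*₃ bk1≉0 bk2≉0 g1≉0 ∷ [])
        refl

      term≈ : inverseKernel m j * K j i ≈ Π * ((n1 * n2) / X2)
      term≈ = solveFactorised 20 17
        (λ b0 n1 Hmj PEmj KiDi Ptji PCji KDi H1 B1 A2 A3 iE iC iD1 iD2 iD3 iD4 n2 X2i →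
          (b0 ● n1 ● Hmj ● PEmj ● KiDi) ● (Ptji ● PCji ● KDi)
            ≐ (b0 ● H1 ● B1 ● A2 ● A3 ● (iE ● iC ● iD1 ● iD2 ● iD3 ● iD4)) ● (n1 ● n2 ● X2i))
        (λ b0 n1 H1 B1 A2 A3 n2 iE iC iD1 ig1 iD2 ig2 iD3 ig3 iD4 ig4 →
          b0 ∷ n1 ∷ H1 ∷ B1 ∷ (iE ● iC ● (iD1 ● ig1) ● (iD2 ● ig2)) ∷ (n2 ● A2) ∷ A3
          ∷ ((iD3 ● ig3) ● (iD4 ● ig4)) ∷ H1 ∷ B1 ∷ A2 ∷ A3 ∷ iE ∷ iC ∷ iD1 ∷ iD2 ∷ iD3 ∷ iD4 ∷ n2
          ∷ (ig1 ● ig2 ● ig3 ● ig4) ∷ [])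
        (b0 ∷ n1 ∷ H1 ∷ B1 ∷ A2 ∷ A3 ∷ n2 ∷ iE ∷ iC ∷ iD1 ∷ g1 ⁻¹ ∷ iD2 ∷ g2 ⁻¹ ∷ iD3 ∷ g3 ⁻¹ ∷ iD4 ∷ g4 ⁻¹ ∷ [])
        (b0 ∷ n1 ∷ dualPoch t q (m ∸ j) ∷ poch E q (m +ℕ j)
          ∷ (bE * bC * poch q q (m ∸ j) * poch (C * q) q (m +ℕ j)) ⁻¹
          ∷ poch t q (j ∸ i) ∷ poch C q (j +ℕ i) ∷ (poch q q (j ∸ i) * poch (E * q) q (j +ℕ i)) ⁻¹
          ∷ H1 ∷ B1 ∷ A2 ∷ A3 ∷ iE ∷ iC ∷ iD1 ∷ iD2 ∷ iD3 ∷ iD4 ∷ n2 ∷ X2 ⁻¹ ∷ [])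
        (refl ∷ refl ∷ reflexive (PE.cong (dualPoch t q) e-mj) ∷ poch-congʳ E q e-mjB
         ∷ trans (⁻¹-cong (*-cong (*-congˡ (poch-congʳ q q e-mj)) (poch-congʳ (C * q) q e-mjC)))
             (trans (⁻¹-distrib-*₄ bE≉0 1−C≉0 (*-≉0 D1≉0 g1≉0) (*-≉0 D2≉0 g2≉0)) (*-cong (*-congˡ (⁻¹-distrib-* D1≉0 g1≉0)) (⁻¹-distrib-* D2≉0 g2≉0)))
         ∷ trans (poch-congʳ t q e-ji) (poch-unfoldˡ t q s)
         ∷ poch-congʳ C q e-jiC
         ∷ trans (⁻¹-cong (*-cong (poch-congʳ q q e-ji) (poch-congʳ (E * q) q e-jiE)))
             (trans (⁻¹-distrib-* (*-≉0 D3≉0 g3≉0) (*-≉0 D4≉0 g4≉0)) (*-cong (⁻¹-distrib-* D3≉0 g3≉0) (⁻¹-distrib-* D4≉0 g4≉0)))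
         ∷ refl ∷ refl ∷ refl ∷ refl ∷ refl ∷ refl ∷ refl ∷ refl ∷ refl ∷ refl ∷ refl
         ∷ ⁻¹-distrib-*₄ g1≉0 g2≉0 g3≉0 g4≉0 ∷ [])
        refl

      next≈ : closedForm m i (suc s) u ≈ Π * ((e1 * e2 * e3) / X3)
      next≈ = solveFactorised 19 19
        (λ b0 Dκi H1 PEG2 A2 e2 PCG2 DG2i iE iC iD1 iD2 iD3 iD4 B1 A3 e1 e3 X3i →
          (b0 ● Dκi) ● (H1 ● PEG2 ● (A2 ● e2) ● PCG2 ● DG2i)
            ≐ (b0 ● H1 ● B1 ● A2 ● A3 ● (iE ● iC ● iD1 ● iD2 ● iD3 ● iD4)) ● (e1 ● e2 ● e3 ● X3i))
        (λ b0 H1 B1 e1 A2 e2 A3 e3 iE iC ik1 ik2 iD1 iD2 ig2 iD3 ig3 iD4 ig4 →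
          b0 ∷ (iE ● iC ● ik1 ● ik2) ∷ H1 ∷ (B1 ● e1) ∷ A2 ∷ e2 ∷ (A3 ● e3)
          ∷ (iD1 ● (iD2 ● ig2) ● (iD3 ● ig3) ● (iD4 ● ig4))
          ∷ iE ∷ iC ∷ iD1 ∷ iD2 ∷ iD3 ∷ iD4 ∷ B1 ∷ A3 ∷ e1 ∷ e3 ∷ (ik1 ● ik2 ● ig2 ● ig3 ● ig4) ∷ [])
        (b0 ∷ H1 ∷ B1 ∷ e1 ∷ A2 ∷ e2 ∷ A3 ∷ e3 ∷ iE ∷ iC ∷ bk1 ⁻¹ ∷ bk2 ⁻¹ ∷ iD1 ∷ iD2 ∷ g2 ⁻¹ ∷ iD3 ∷ g3 ⁻¹ ∷ iD4 ∷ g4 ⁻¹ ∷ [])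
        (b0 ∷ (bE * bC * bk1 * bk2) ⁻¹ ∷ H1 ∷ poch E q (2 *ℕ i +ℕ 2 *ℕ suc s +ℕ u +ℕ 2) ∷ A2 ∷ e2
          ∷ poch C q (2 *ℕ i +ℕ suc s +ℕ 1)
          ∷ (D1 * poch (C * q) q (2 *ℕ i +ℕ 2 *ℕ suc s +ℕ u +ℕ 1) * (D3 * g3) * poch (E * q) q (2 *ℕ i +ℕ suc s)) ⁻¹
          ∷ iE ∷ iC ∷ iD1 ∷ iD2 ∷ iD3 ∷ iD4 ∷ B1 ∷ A3 ∷ e1 ∷ e3 ∷ X3 ⁻¹ ∷ [])
        (refl ∷ ⁻¹-distrib-*₄ bE≉0 1−C≉0 bk1≉0 bk2≉0 ∷ refl ∷ poch-congʳ E q e-nextB ∷ refl ∷ refl ∷ poch-congʳ C q e-nextC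
         ∷ trans (⁻¹-cong (*-cong (*-congʳ (*-congˡ (poch-congʳ (C * q) q e-nextCq))) (poch-congʳ (E * q) q e-nextE)))
             (trans (⁻¹-distrib-*₄ D1≉0 (*-≉0 D2≉0 g2≉0) (*-≉0 D3≉0 g3≉0) (*-≉0 D4≉0 g4≉0))
                    (*-cong (*-cong (*-congˡ (⁻¹-distrib-* D2≉0 g2≉0)) (⁻¹-distrib-* D3≉0 g3≉0)) (⁻¹-distrib-* D4≉0 g4≉0)))
         ∷ refl ∷ refl ∷ refl ∷ refl ∷ refl ∷ refl ∷ refl ∷ refl ∷ refl ∷ refl
         ∷ ⁻¹-distrib-*₅ bk1≉0 bk2≉0 g2≉0 g3≉0 g4≉0 ∷ [])
        refl

      cross-multiplied : (f1 * X2 + n1 * n2 * X1) * X3 ≈ e1 * e2 * e3 * (X1 * X2)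
      cross-multiplied = begin
        (f1 * X2 + n1 * n2 * X1) * X3 ≈⟨ l1 f1 g1 g2 g3 g4 n1 n2 bk1 bk2 ⟩
        (g1 * bk1 * bk2 * g2 * g3 * g4) * (f1 * g2 * g3 * g4 + n1 * n2 * bk1 * bk2) ≈⟨ *-congˡ step-identity ⟩
        (g1 * bk1 * bk2 * g2 * g3 * g4) * (e1 * e2 * e3 * g1) ≈⟨ l2 e1 e2 e3 g1 g2 g3 g4 bk1 bk2 ⟩
        e1 * e2 * e3 * (X1 * X2) ∎
        where
        l1 : ∀ f1 g1 g2 g3 g4 n1 n2 bk1 bk2 →
          (f1 * (g1 * g2 * g3 * g4) + n1 * n2 * (bk1 * bk2 * g1)) * (bk1 * bk2 * g2 * g3 * g4)
            ≈ (g1 * bk1 * bk2 * g2 * g3 * g4) * (f1 * g2 * g3 * g4 + n1 * n2 * bk1 * bk2)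
        l1 = solve 9 (λ f1 g1 g2 g3 g4 n1 n2 bk1 bk2 →
          (f1 :* (g1 :* g2 :* g3 :* g4) :+ n1 :* n2 :* (bk1 :* bk2 :* g1)) :* (bk1 :* bk2 :* g2 :* g3 :* g4)
            := (g1 :* bk1 :* bk2 :* g2 :* g3 :* g4) :* (f1 :* g2 :* g3 :* g4 :+ n1 :* n2 :* bk1 :* bk2)) refl
        l2 : ∀ e1 e2 e3 g1 g2 g3 g4 bk1 bk2 →
          (g1 * bk1 * bk2 * g2 * g3 * g4) * (e1 * e2 * e3 * g1) ≈ e1 * e2 * e3 * ((bk1 * bk2 * g1) * (g1 * g2 * g3 * g4))
        l2 = solve 9 (λ e1 e2 e3 g1 g2 g3 g4 bk1 bk2 →
          (g1 :* bk1 :* bk2 :* g2 :* g3 :* g4) :* (e1 :* e2 :* e3 :* g1)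
            := e1 :* e2 :* e3 :* ((bk1 :* bk2 :* g1) :* (g1 :* g2 :* g3 :* g4))) refl

      scaled-step : f1 / X1 + (n1 * n2) / X2 ≈ (e1 * e2 * e3) / X3
      scaled-step = trans (/-+-/ X1≉0 X2≉0) (cross⇒/≈/ (*-≉0 X1≉0 X2≉0) X3≉0 cross-multiplied)

      closedForm-step : closedForm m i s (suc u) + inverseKernel m j * K j i ≈ closedForm m i (suc s) u
      closedForm-step = begin
        closedForm m i s (suc u) + inverseKernel m j * K j i ≈⟨ +-cong previous≈ term≈ ⟩
        Π * (f1 / X1) + Π * ((n1 * n2) / X2) ≈⟨ sym (distribˡ _ _ _) ⟩
        Π * (f1 / X1 + (n1 * n2) / X2) ≈⟨ *-congˡ scaled-step ⟩
        Π * ((e1 * e2 * e3) / X3) ≈⟨ sym next≈ ⟩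
        closedForm m i (suc s) u ∎

    module ClosedFormBase (i u : ℕ) where
      m : ℕ
      m = i +ℕ 0 +ℕ u +ℕ 1
      b0 bE bC bk1 bk2 n1 e1 g1 H1 PE0 PC0 D1 D2 D4 Π : Carrier
      b0 = 1# − E * q ^ (2 *ℕ m)
      bE = 1# − E
      bC = 1# − C
      bk1 = 1# − E * q ^ (m +ℕ i)
      bk2 = 1# − q ^ (m ∸ i)
      n1 = 1# − C * q ^ (2 *ℕ i)
      e1 = 1# − E * q ^ (2 *ℕ i +ℕ u +ℕ 1)
      g1 = 1# − q * q ^ u
      H1 = dualPoch t q (suc u)
      PE0 = poch E q (2 *ℕ i +ℕ u +ℕ 1)
      PC0 = poch C q (2 *ℕ i)
      D1 = poch q q u
      D2 = poch (C * q) q (2 *ℕ i +ℕ u +ℕ 1)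
      D4 = poch (E * q) q (2 *ℕ i)
      Π = b0 * H1 * PE0 * PC0 * n1 * (bE ⁻¹ * bC ⁻¹ * D1 ⁻¹ * D2 ⁻¹ * D4 ⁻¹)

      e-mi : m ∸ i PE.≡ suc u
      e-mi = PE.trans (PE.cong (_∸ i) (m≡i+[1+u] i u)) (ℕP.m+n∸m≡n i (suc u)) where
        m≡i+[1+u] : ∀ i u → i +ℕ 0 +ℕ u +ℕ 1 PE.≡ i +ℕ suc u
        m≡i+[1+u] = solve-∀
      e-m+i : m +ℕ i PE.≡ 2 *ℕ i +ℕ u +ℕ 1
      e-m+i = e-m+i′ i u where
        e-m+i′ : ∀ i u → i +ℕ 0 +ℕ u +ℕ 1 +ℕ i PE.≡ 2 *ℕ i +ℕ u +ℕ 1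
        e-m+i′ = solve-∀
      e-ii : i +ℕ i PE.≡ 2 *ℕ i
      e-ii = e-ii′ i where
        e-ii′ : ∀ i → i +ℕ i PE.≡ 2 *ℕ i
        e-ii′ = solve-∀
      e-closedE : 2 *ℕ i +ℕ 2 *ℕ 0 +ℕ u +ℕ 2 PE.≡ suc (2 *ℕ i +ℕ u +ℕ 1)
      e-closedE = e-closedE′ i u where
        e-closedE′ : ∀ i u → 2 *ℕ i +ℕ 2 *ℕ 0 +ℕ u +ℕ 2 PE.≡ suc (2 *ℕ i +ℕ u +ℕ 1)
        e-closedE′ = solve-∀
      e-closedC : 2 *ℕ i +ℕ 0 +ℕ 1 PE.≡ suc (2 *ℕ i)
      e-closedC = e-closedC′ i where
        e-closedC′ : ∀ i → 2 *ℕ i +ℕ 0 +ℕ 1 PE.≡ suc (2 *ℕ i)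
        e-closedC′ = solve-∀
      e-closedCq : 2 *ℕ i +ℕ 2 *ℕ 0 +ℕ u +ℕ 1 PE.≡ 2 *ℕ i +ℕ u +ℕ 1
      e-closedCq = e-closedCq′ i u where
        e-closedCq′ : ∀ i u → 2 *ℕ i +ℕ 2 *ℕ 0 +ℕ u +ℕ 1 PE.≡ 2 *ℕ i +ℕ u +ℕ 1
        e-closedCq′ = solve-∀
      e-closedEq : 2 *ℕ i +ℕ 0 PE.≡ 2 *ℕ i
      e-closedEq = ℕP.+-identityʳ _

      g1≉0 : g1 ≉0
      g1≉0 = poch-last-factor-≉0 q q u (poch-q≉0 (suc u))
      e1≉0 : e1 ≉0
      e1≉0 = poch-shifted-factor-≉0 E q (2 *ℕ i +ℕ u) (2i+u+1≡1+[2i+u] i u) (poch-Eq≉0 (suc (2 *ℕ i +ℕ u))) where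
        2i+u+1≡1+[2i+u] : ∀ i u → 2 *ℕ i +ℕ u +ℕ 1 PE.≡ suc (2 *ℕ i +ℕ u)
        2i+u+1≡1+[2i+u] = solve-∀
      bk1≈e1 : bk1 ≈ e1
      bk1≈e1 = 1−‿cong (*-congˡ (^-congʳ q e-m+i))
      bk2≈g1 : bk2 ≈ g1
      bk2≈g1 = 1−‿cong (^-congʳ q e-mi)
      bk1≉0 : bk1 ≉0
      bk1≉0 = ≉0-cong (sym bk1≈e1) e1≉0
      bk2≉0 : bk2 ≉0
      bk2≉0 = ≉0-cong (sym bk2≈g1) g1≉0
      D1≉0 = poch-q≉0 u
      D2≉0 = poch-Cq≉0 (2 *ℕ i +ℕ u +ℕ 1)
      D4≉0 = poch-Eq≉0 (2 *ℕ i)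

      term≈ : inverseKernel m i * K i i ≈ Π * g1 ⁻¹
      term≈ = solveFactorised 13 11
        (λ b0 n1 Hmi PEmi Kid Pt0 PCii KDi H1 PE0 PC0 iD124 ig1s →
          (b0 ● n1 ● Hmi ● PEmi ● Kid) ● (Pt0 ● PCii ● KDi) ≐ (b0 ● H1 ● PE0 ● PC0 ● n1 ● iD124) ● ig1s)
        (λ b0 n1 H1 PE0 PC0 iE iC iD1 ig1 iD2 iD4 →
          b0 ∷ n1 ∷ H1 ∷ PE0 ∷ (iE ● iC ● (iD1 ● ig1) ● iD2) ∷ unit ∷ PC0 ∷ iD4 ∷ H1 ∷ PE0 ∷ PC0
          ∷ (iE ● iC ● iD1 ● iD2 ● iD4) ∷ ig1 ∷ [])
        (b0 ∷ n1 ∷ H1 ∷ PE0 ∷ PC0 ∷ bE ⁻¹ ∷ bC ⁻¹ ∷ D1 ⁻¹ ∷ g1 ⁻¹ ∷ D2 ⁻¹ ∷ D4 ⁻¹ ∷ [])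
        (b0 ∷ n1 ∷ dualPoch t q (m ∸ i) ∷ poch E q (m +ℕ i) ∷ (bE * bC * poch q q (m ∸ i) * poch (C * q) q (m +ℕ i)) ⁻¹
          ∷ poch t q (i ∸ i) ∷ poch C q (i +ℕ i) ∷ (poch q q (i ∸ i) * poch (E * q) q (i +ℕ i)) ⁻¹
          ∷ H1 ∷ PE0 ∷ PC0 ∷ (bE ⁻¹ * bC ⁻¹ * D1 ⁻¹ * D2 ⁻¹ * D4 ⁻¹) ∷ g1 ⁻¹ ∷ [])
        (refl ∷ refl ∷ reflexive (PE.cong (dualPoch t q) e-mi) ∷ poch-congʳ E q e-m+i
         ∷ trans (⁻¹-cong (*-cong (*-congˡ (poch-congʳ q q e-mi)) (poch-congʳ (C * q) q e-m+i)))
             (trans (⁻¹-distrib-*₄ 1−E≉0 1−C≉0 (*-≉0 D1≉0 g1≉0) D2≉0) (*-congʳ (*-congˡ (⁻¹-distrib-* D1≉0 g1≉0))))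
         ∷ poch-congʳ t q (ℕP.n∸n≡0 i) ∷ poch-congʳ C q e-ii
         ∷ trans (⁻¹-cong (*-cong (poch-congʳ q q (ℕP.n∸n≡0 i)) (poch-congʳ (E * q) q e-ii)))
             (⁻¹-cong (*-identityˡ _))
         ∷ refl ∷ refl ∷ refl ∷ refl ∷ refl ∷ [])
        refl

      closedForm≈ : closedForm m i 0 u ≈ Π * (e1 * (bk1 ⁻¹ * bk2 ⁻¹))
      closedForm≈ = solveFactorised 12 13
        (λ b0 Dκi H1 PEG PCG DGi PE0 PC0 n1 iD124 e1s ik12 →
          (b0 ● Dκi) ● (H1 ● PEG ● unit ● PCG ● DGi) ≐ (b0 ● H1 ● PE0 ● PC0 ● n1 ● iD124) ● (e1s ● ik12))
        (λ b0 H1 PE0 e1 PC0 n1 iE iC ik1 ik2 iD1 iD2 iD4 →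
          b0 ∷ (iE ● iC ● ik1 ● ik2) ∷ H1 ∷ (PE0 ● e1) ∷ (PC0 ● n1) ∷ (iD1 ● iD2 ● iD4) ∷ PE0 ∷ PC0 ∷ n1
          ∷ (iE ● iC ● iD1 ● iD2 ● iD4) ∷ e1 ∷ (ik1 ● ik2) ∷ [])
        (b0 ∷ H1 ∷ PE0 ∷ e1 ∷ PC0 ∷ n1 ∷ bE ⁻¹ ∷ bC ⁻¹ ∷ bk1 ⁻¹ ∷ bk2 ⁻¹ ∷ D1 ⁻¹ ∷ D2 ⁻¹ ∷ D4 ⁻¹ ∷ [])
        (b0 ∷ (bE * bC * bk1 * bk2) ⁻¹ ∷ H1 ∷ poch E q (2 *ℕ i +ℕ 2 *ℕ 0 +ℕ u +ℕ 2) ∷ poch C q (2 *ℕ i +ℕ 0 +ℕ 1)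
          ∷ (D1 * poch (C * q) q (2 *ℕ i +ℕ 2 *ℕ 0 +ℕ u +ℕ 1) * 1# * poch (E * q) q (2 *ℕ i +ℕ 0)) ⁻¹
          ∷ PE0 ∷ PC0 ∷ n1 ∷ (bE ⁻¹ * bC ⁻¹ * D1 ⁻¹ * D2 ⁻¹ * D4 ⁻¹) ∷ e1 ∷ bk1 ⁻¹ * bk2 ⁻¹ ∷ [])
        (refl ∷ ⁻¹-distrib-*₄ 1−E≉0 1−C≉0 bk1≉0 bk2≉0 ∷ refl ∷ poch-congʳ E q e-closedE ∷ poch-congʳ C q e-closedC
         ∷ trans (⁻¹-cong (*-cong (trans (*-identityʳ _) (*-congˡ (poch-congʳ (C * q) q e-closedCq))) (poch-congʳ (E * q) q e-closedEq)))
             (⁻¹-distrib-*₃ D1≉0 D2≉0 D4≉0)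
         ∷ refl ∷ refl ∷ refl ∷ refl ∷ refl ∷ refl ∷ [])
        refl

      e1/[bk1*bk2]≈1/g1 : e1 * (bk1 ⁻¹ * bk2 ⁻¹) ≈ g1 ⁻¹
      e1/[bk1*bk2]≈1/g1 = begin
        e1 * (bk1 ⁻¹ * bk2 ⁻¹) ≈⟨ *-congˡ (*-cong (⁻¹-cong bk1≈e1) (⁻¹-cong bk2≈g1)) ⟩
        e1 * (e1 ⁻¹ * g1 ⁻¹) ≈⟨ sym (*-assoc _ _ _) ⟩
        (e1 * e1 ⁻¹) * g1 ⁻¹ ≈⟨ *-congʳ (⁻¹-inverseʳ e1≉0) ⟩
        1# * g1 ⁻¹ ≈⟨ *-identityˡ _ ⟩
        g1 ⁻¹ ∎

      closedForm-base : inverseKernel m i * K i i ≈ closedForm m i 0 u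
      closedForm-base = trans term≈ (trans (*-congˡ (sym e1/[bk1*bk2]≈1/g1)) (sym closedForm≈))

    module ClosedFormLast (i s : ℕ) where
      m j L2 L3 L4 : ℕ
      m = i +ℕ s +ℕ 0 +ℕ 1
      j = i +ℕ suc s
      L2 = 2 *ℕ i +ℕ 2 *ℕ s +ℕ 0 +ℕ 1
      L3 = 2 *ℕ i +ℕ s +ℕ 1
      L4 = 2 *ℕ i +ℕ s

      b0 bE bC bk1 bk2 tm1 g2 g3 g4 n1 n2 : Carrier
      b0 = 1# − E * q ^ (2 *ℕ m)
      bE = 1# − E
      bC = 1# − C
      bk1 = 1# − E * q ^ (m +ℕ i)
      bk2 = 1# − q ^ (m ∸ i)
      tm1 = t − 1#
      g2 = 1# − C * q * q ^ L2
      g3 = 1# − q * q ^ s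
      g4 = 1# − E * q * q ^ L4
      n1 = 1# − C * q ^ (2 *ℕ j)
      n2 = 1# − t

      B A2 A3 D2 D3 D4 Π X1 X2 : Carrier
      B = poch E q (2 *ℕ i +ℕ 2 *ℕ s +ℕ 0 +ℕ 2)
      A2 = poch (t * q) q s
      A3 = poch C q L3
      D2 = poch (C * q) q L2
      D3 = poch q q s
      D4 = poch (E * q) q L4
      Π = b0 * B * A2 * A3 * (bE ⁻¹ * bC ⁻¹ * D2 ⁻¹ * D3 ⁻¹ * D4 ⁻¹)
      X1 = bk1 * bk2
      X2 = g2 * g3 * g4

      e-mj : m ∸ j PE.≡ 0
      e-mj = PE.trans (PE.cong (_∸ j) (m≡j i s)) (ℕP.n∸n≡0 j) where
        m≡j : ∀ i s → i +ℕ s +ℕ 0 +ℕ 1 PE.≡ i +ℕ suc s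
        m≡j = solve-∀
      e-mjB : m +ℕ j PE.≡ 2 *ℕ i +ℕ 2 *ℕ s +ℕ 0 +ℕ 2
      e-mjB = e-mjB′ i s where
        e-mjB′ : ∀ i s → i +ℕ s +ℕ 0 +ℕ 1 +ℕ (i +ℕ suc s) PE.≡ 2 *ℕ i +ℕ 2 *ℕ s +ℕ 0 +ℕ 2
        e-mjB′ = solve-∀
      e-mjC : m +ℕ j PE.≡ suc L2
      e-mjC = e-mjC′ i s where
        e-mjC′ : ∀ i s → i +ℕ s +ℕ 0 +ℕ 1 +ℕ (i +ℕ suc s) PE.≡ suc (2 *ℕ i +ℕ 2 *ℕ s +ℕ 0 +ℕ 1)
        e-mjC′ = solve-∀
      e-ji : j ∸ i PE.≡ suc s
      e-ji = ℕP.m+n∸m≡n i (suc s)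
      e-jiC : j +ℕ i PE.≡ L3
      e-jiC = e-jiC′ i s where
        e-jiC′ : ∀ i s → i +ℕ suc s +ℕ i PE.≡ 2 *ℕ i +ℕ s +ℕ 1
        e-jiC′ = solve-∀
      e-jiE : j +ℕ i PE.≡ suc L4
      e-jiE = e-jiE′ i s where
        e-jiE′ : ∀ i s → i +ℕ suc s +ℕ i PE.≡ suc (2 *ℕ i +ℕ s)
        e-jiE′ = solve-∀
      e-mi : m +ℕ i PE.≡ suc L4
      e-mi = e-mi′ i s where
        e-mi′ : ∀ i s → i +ℕ s +ℕ 0 +ℕ 1 +ℕ i PE.≡ suc (2 *ℕ i +ℕ s)
        e-mi′ = solve-∀
      e-m∸i : m ∸ i PE.≡ suc s
      e-m∸i = PE.trans (PE.cong (_∸ i) (m≡i+[1+s] i s)) (ℕP.m+n∸m≡n i (suc s)) where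
        m≡i+[1+s] : ∀ i s → i +ℕ s +ℕ 0 +ℕ 1 PE.≡ i +ℕ suc s
        m≡i+[1+s] = solve-∀
      e-2j : 2 *ℕ j PE.≡ suc L2
      e-2j = e-2j′ i s where
        e-2j′ : ∀ i s → 2 *ℕ (i +ℕ suc s) PE.≡ suc (2 *ℕ i +ℕ 2 *ℕ s +ℕ 0 +ℕ 1)
        e-2j′ = solve-∀

      g2≉0 : g2 ≉0
      g2≉0 = poch-last-factor-≉0 (C * q) q L2 (poch-Cq≉0 (suc L2))
      g3≉0 : g3 ≉0
      g3≉0 = poch-last-factor-≉0 q q s (poch-q≉0 (suc s))
      g4≉0 : g4 ≉0
      g4≉0 = poch-last-factor-≉0 (E * q) q L4 (poch-Eq≉0 (suc L4))
      bk1≉0 : bk1 ≉0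
      bk1≉0 = poch-shifted-factor-≉0 E q L4 e-mi (poch-Eq≉0 (suc L4))
      bk2≉0 : bk2 ≉0
      bk2≉0 = ≉0-cong (1−‿cong (sym (^-congʳ q e-m∸i))) g3≉0
      D2≉0 = poch-Cq≉0 L2
      D3≉0 = poch-q≉0 s
      D4≉0 = poch-Eq≉0 L4
      X1≉0 : X1 ≉0
      X1≉0 = *-≉0 bk1≉0 bk2≉0
      X2≉0 : X2 ≉0
      X2≉0 = *₃-≉0 g2≉0 g3≉0 g4≉0

      closedForm≈ : closedForm m i s 0 ≈ Π * (tm1 / X1)
      closedForm≈ = solveFactorised 15 12
        (λ b0 Dκi H1 PB A2 A3 DGi B iE iC iD2 iD3 iD4 tm1s X1i →
          (b0 ● Dκi) ● (H1 ● PB ● A2 ● A3 ● DGi) ≐ (b0 ● B ● A2 ● A3 ● (iE ● iC ● iD2 ● iD3 ● iD4)) ● (tm1s ● X1i))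
        (λ b0 B A2 A3 tm1 iE iC ik1 ik2 iD2 iD3 iD4 →
          b0 ∷ (iE ● iC ● ik1 ● ik2) ∷ tm1 ∷ B ∷ A2 ∷ A3 ∷ (iD2 ● iD3 ● iD4) ∷ B ∷ iE ∷ iC ∷ iD2 ∷ iD3 ∷ iD4
          ∷ tm1 ∷ (ik1 ● ik2) ∷ [])
        (b0 ∷ B ∷ A2 ∷ A3 ∷ tm1 ∷ bE ⁻¹ ∷ bC ⁻¹ ∷ bk1 ⁻¹ ∷ bk2 ⁻¹ ∷ D2 ⁻¹ ∷ D3 ⁻¹ ∷ D4 ⁻¹ ∷ [])
        (b0 ∷ (bE * bC * bk1 * bk2) ⁻¹ ∷ dualPoch t q 1 ∷ B ∷ A2 ∷ A3 ∷ (1# * D2 * D3 * D4) ⁻¹ ∷ B ∷ bE ⁻¹ ∷ bC ⁻¹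
          ∷ D2 ⁻¹ ∷ D3 ⁻¹ ∷ D4 ⁻¹ ∷ tm1 ∷ X1 ⁻¹ ∷ [])
        (refl ∷ ⁻¹-distrib-*₄ 1−E≉0 1−C≉0 bk1≉0 bk2≉0 ∷ trans (*-identityˡ _) (+-congˡ (-‿cong refl)) ∷ refl ∷ refl ∷ refl
         ∷ trans (⁻¹-cong (*-congʳ (*-congʳ (*-identityˡ _)))) (⁻¹-distrib-*₃ D2≉0 D3≉0 D4≉0)
         ∷ refl ∷ refl ∷ refl ∷ refl ∷ refl ∷ refl ∷ refl ∷ ⁻¹-distrib-* bk1≉0 bk2≉0 ∷ [])
        refl

      term≈ : inverseKernel m j * K j i ≈ Π * ((n1 * n2) / X2)
      term≈ = solveFactorised 18 14
        (λ b0 n1 Hmj PEmj KiDi Ptji PCji KDi B A2 A3 iE iC iD2 iD3 iD4 n2 X2i →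
          (b0 ● n1 ● Hmj ● PEmj ● KiDi) ● (Ptji ● PCji ● KDi)
            ≐ (b0 ● B ● A2 ● A3 ● (iE ● iC ● iD2 ● iD3 ● iD4)) ● (n1 ● n2 ● X2i))
        (λ b0 n1 B A2 A3 n2 iE iC iD2 ig2 iD3 ig3 iD4 ig4 →
          b0 ∷ n1 ∷ unit ∷ B ∷ (iE ● iC ● unit ● (iD2 ● ig2)) ∷ (n2 ● A2) ∷ A3 ∷ ((iD3 ● ig3) ● (iD4 ● ig4))
          ∷ B ∷ A2 ∷ A3 ∷ iE ∷ iC ∷ iD2 ∷ iD3 ∷ iD4 ∷ n2 ∷ (ig2 ● ig3 ● ig4) ∷ [])
        (b0 ∷ n1 ∷ B ∷ A2 ∷ A3 ∷ n2 ∷ bE ⁻¹ ∷ bC ⁻¹ ∷ D2 ⁻¹ ∷ g2 ⁻¹ ∷ D3 ⁻¹ ∷ g3 ⁻¹ ∷ D4 ⁻¹ ∷ g4 ⁻¹ ∷ [])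
        (b0 ∷ n1 ∷ dualPoch t q (m ∸ j) ∷ poch E q (m +ℕ j)
          ∷ (bE * bC * poch q q (m ∸ j) * poch (C * q) q (m +ℕ j)) ⁻¹
          ∷ poch t q (j ∸ i) ∷ poch C q (j +ℕ i) ∷ (poch q q (j ∸ i) * poch (E * q) q (j +ℕ i)) ⁻¹
          ∷ B ∷ A2 ∷ A3 ∷ bE ⁻¹ ∷ bC ⁻¹ ∷ D2 ⁻¹ ∷ D3 ⁻¹ ∷ D4 ⁻¹ ∷ n2 ∷ X2 ⁻¹ ∷ [])
        (refl ∷ refl ∷ reflexive (PE.cong (dualPoch t q) e-mj) ∷ poch-congʳ E q e-mjB
         ∷ trans (⁻¹-cong (*-cong (*-congˡ (poch-congʳ q q e-mj)) (poch-congʳ (C * q) q e-mjC)))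
             (trans (⁻¹-distrib-*₄ 1−E≉0 1−C≉0 1≉0 (*-≉0 D2≉0 g2≉0)) (*-cong (*-congˡ 1⁻¹≈1) (⁻¹-distrib-* D2≉0 g2≉0)))
         ∷ trans (poch-congʳ t q e-ji) (poch-unfoldˡ t q s)
         ∷ poch-congʳ C q e-jiC
         ∷ trans (⁻¹-cong (*-cong (poch-congʳ q q e-ji) (poch-congʳ (E * q) q e-jiE)))
             (trans (⁻¹-distrib-* (*-≉0 D3≉0 g3≉0) (*-≉0 D4≉0 g4≉0)) (*-cong (⁻¹-distrib-* D3≉0 g3≉0) (⁻¹-distrib-* D4≉0 g4≉0)))
         ∷ refl ∷ refl ∷ refl ∷ refl ∷ refl ∷ refl ∷ refl ∷ refl ∷ refl ∷ ⁻¹-distrib-*₃ g2≉0 g3≉0 g4≉0 ∷ [])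
        refl

      numerator≈0 : tm1 * X2 + n1 * n2 * X1 ≈ 0#
      numerator≈0 = solveSubstituted 8 4
        (λ tm1 g2 g3 g4 n1 n2 bk1 bk2 → tm1 :* (g2 :* g3 :* g4) :+ n1 :* n2 :* (bk1 :* bk2) := con (+ 0))
        (λ t w1 w2 w3 → let one = con (+ 1) in
          (t :+ :- one) ∷ (one :+ :- w1) ∷ (one :+ :- w2) ∷ (one :+ :- w3) ∷ (one :+ :- w1) ∷ (one :+ :- t)
          ∷ (one :+ :- w3) ∷ (one :+ :- w2) ∷ [])
        (t ∷ C * q * q ^ L2 ∷ q * q ^ s ∷ E * q * q ^ L4 ∷ [])
        (tm1 ∷ g2 ∷ g3 ∷ g4 ∷ n1 ∷ n2 ∷ bk1 ∷ bk2 ∷ [])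
        (refl ∷ refl ∷ refl ∷ refl
         ∷ 1−‿cong (trans (*-congˡ (^-congʳ q e-2j)) (sym (*-assoc _ _ _)))
         ∷ refl
         ∷ 1−‿cong (trans (*-congˡ (^-congʳ q e-mi)) (sym (*-assoc _ _ _)))
         ∷ 1−‿cong (^-congʳ q e-m∸i)
         ∷ [])
        refl

      closedForm-last : closedForm m i s 0 + inverseKernel m j * K j i ≈ 0#
      closedForm-last = begin
        closedForm m i s 0 + inverseKernel m j * K j i ≈⟨ +-cong closedForm≈ term≈ ⟩
        Π * (tm1 / X1) + Π * ((n1 * n2) / X2) ≈⟨ sym (distribˡ _ _ _) ⟩
        Π * (tm1 / X1 + (n1 * n2) / X2) ≈⟨ *-congˡ (/-+-/ X1≉0 X2≉0) ⟩
        Π * ((tm1 * X2 + n1 * n2 * X1) / (X1 * X2)) ≈⟨ y≈0⇒x*y≈0 (x≈0⇒x*y≈0 numerator≈0) ⟩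
        0# ∎

    module Diagonal (m : ℕ) where
      b0 n1 PE PC PEq PCq : Carrier
      b0 = 1# − E * q ^ (2 *ℕ m)
      n1 = 1# − C * q ^ (2 *ℕ m)
      PE = poch E q (m +ℕ m)
      PC = poch C q (m +ℕ m)
      PEq = poch (E * q) q (m +ℕ m)
      PCq = poch (C * q) q (m +ℕ m)

      e2m : 2 *ℕ m PE.≡ m +ℕ m
      e2m = PE.cong (m +ℕ_) (ℕP.+-identityʳ m)

      poch-shift-rel : ∀ x → x * q ^ (2 *ℕ m) ≈ x * q ^ (m +ℕ m) →
                       (1# − x * q ^ (2 *ℕ m)) * poch x q (m +ℕ m) ≈ (1# − x) * poch (x * q) q (m +ℕ m)
      poch-shift-rel x h = trans (*-comm _ _) (trans (*-congˡ (1−‿cong h)) (poch-unfoldˡ x q (m +ℕ m)))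

      bE bC Pq0 Hmm Ptmm : Carrier
      bE = 1# − E
      bC = 1# − C
      Pq0 = poch q q (m ∸ m)
      Hmm = dualPoch t q (m ∸ m)
      Ptmm = poch t q (m ∸ m)

      relE : b0 * PE ≈ bE * PEq
      relE = poch-shift-rel E (*-congˡ (^-congʳ q e2m))
      relC : n1 * PC ≈ bC * PCq
      relC = poch-shift-rel C (*-congˡ (^-congʳ q e2m))

      numerator≈denominator : (b0 * n1 * Hmm * PE) * (Ptmm * PC) ≈ (bE * bC * Pq0 * PCq) * (Pq0 * PEq)
      numerator≈denominator = begin
        (b0 * n1 * Hmm * PE) * (Ptmm * PC)
          ≈⟨ solveFactorised 6 4 (λ b0 n1 Hmm PE Ptmm PC → (b0 ● n1 ● Hmm ● PE) ● (Ptmm ● PC) ≐ (b0 ● PE) ● (n1 ● PC))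
                (λ b0 n1 PE PC → b0 ∷ n1 ∷ unit ∷ PE ∷ unit ∷ PC ∷ [])
                (b0 ∷ n1 ∷ PE ∷ PC ∷ []) (b0 ∷ n1 ∷ Hmm ∷ PE ∷ Ptmm ∷ PC ∷ [])
                (refl ∷ refl ∷ reflexive (PE.cong (dualPoch t q) (ℕP.n∸n≡0 m)) ∷ refl ∷ poch-congʳ t q (ℕP.n∸n≡0 m) ∷ refl ∷ [])
                refl ⟩
        (b0 * PE) * (n1 * PC) ≈⟨ *-cong relE relC ⟩
        (bE * PEq) * (bC * PCq)
          ≈⟨ solveFactorised 5 4 (λ bE PEq bC PCq Pq0 → (bE ● PEq) ● (bC ● PCq) ≐ (bE ● bC ● Pq0 ● PCq) ● (Pq0 ● PEq))
                (λ bE PEq bC PCq → bE ∷ PEq ∷ bC ∷ PCq ∷ unit ∷ [])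
                (bE ∷ PEq ∷ bC ∷ PCq ∷ []) (bE ∷ PEq ∷ bC ∷ PCq ∷ Pq0 ∷ [])
                (refl ∷ refl ∷ refl ∷ refl ∷ poch-congʳ q q (ℕP.n∸n≡0 m) ∷ [])
                refl ⟩
        (bE * bC * Pq0 * PCq) * (Pq0 * PEq) ∎

      inverseKernel-diagonal : inverseKernel m m * K m m ≈ 1#
      inverseKernel-diagonal = trans (/-*-/ denominator₁≉0 denominator₂≉0)
                                     (/-self numerator≈denominator (*-≉0 denominator₁≉0 denominator₂≉0))
        where
        denominator₁≉0 : (bE * bC * Pq0 * PCq) ≉0
        denominator₁≉0 = *₄-≉0 1−E≉0 1−C≉0 (poch-q≉0 (m ∸ m)) (poch-Cq≉0 (m +ℕ m))
        denominator₂≉0 : (Pq0 * PEq) ≉0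
        denominator₂≉0 = *-≉0 (poch-q≉0 (m ∸ m)) (poch-Eq≉0 (m +ℕ m))

    partialSum : ℕ → ℕ → ℕ → Carrier
    partialSum m i s = Σ≤ s (λ s′ → inverseKernel m (i +ℕ s′) * K (i +ℕ s′) i)

    partialSum≈closedForm : ∀ i s u m → m PE.≡ i +ℕ s +ℕ u +ℕ 1 → partialSum m i s ≈ closedForm m i s u
    partialSum≈closedForm i zero u m PE.refl =
      PE.subst (λ j → inverseKernel m j * K j i ≈ closedForm m i 0 u) (PE.sym (ℕP.+-identityʳ i)) (ClosedFormBase.closedForm-base i u)
    partialSum≈closedForm i (suc s) u m m≡ = begin
      partialSum m i s + inverseKernel m (i +ℕ suc s) * K (i +ℕ suc s) i
        ≈⟨ +-congʳ (partialSum≈closedForm i s (suc u) m (PE.trans m≡ (shift-u i s u))) ⟩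
      closedForm m i s (suc u) + inverseKernel m (i +ℕ suc s) * K (i +ℕ suc s) i
        ≈⟨ PE.subst (λ M → closedForm M i s (suc u) + inverseKernel M (i +ℕ suc s) * K (i +ℕ suc s) i ≈ closedForm M i (suc s) u)
                    (PE.sym (PE.trans m≡ (normalise-m i s u))) (ClosedFormStep.closedForm-step i s u) ⟩
      closedForm m i (suc s) u ∎
      where
      shift-u : ∀ i s u → i +ℕ suc s +ℕ u +ℕ 1 PE.≡ i +ℕ s +ℕ suc u +ℕ 1
      shift-u = solve-∀
      normalise-m : ∀ i s u → i +ℕ suc s +ℕ u +ℕ 1 PE.≡ i +ℕ s +ℕ u +ℕ 2
      normalise-m = solve-∀

    inverseKernel-orthogonal-< : ∀ i m → i < m → partialSum m i (m ∸ i) ≈ 0#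
    inverseKernel-orthogonal-< i m i<m = begin
      partialSum m i (m ∸ i)                                                ≡⟨ PE.cong (partialSum m i) m∸i≡1+N ⟩
      partialSum m i N + inverseKernel m (i +ℕ suc N) * K (i +ℕ suc N) i    ≈⟨ +-congʳ (partialSum≈closedForm i N 0 m m≡) ⟩
      closedForm m i N 0 + inverseKernel m (i +ℕ suc N) * K (i +ℕ suc N) i  ≈⟨ last ⟩
      0#                                                                    ∎
      where
      N : ℕ
      N = m ∸ suc i
      m∸i≡1+N : m ∸ i PE.≡ suc N
      m∸i≡1+N = ℕP.+-∸-assoc 1 i<m
      m≡ : m PE.≡ i +ℕ N +ℕ 0 +ℕ 1
      m≡ = PE.trans (PE.sym (ℕP.m+[n∸m]≡n (ℕP.<⇒≤ i<m))) (PE.trans (PE.cong (i +ℕ_) m∸i≡1+N) (i+[1+N] i N))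
        where
        i+[1+N] : ∀ i N → i +ℕ suc N PE.≡ i +ℕ N +ℕ 0 +ℕ 1
        i+[1+N] = solve-∀
      last : closedForm m i N 0 + inverseKernel m (i +ℕ suc N) * K (i +ℕ suc N) i ≈ 0#
      last = PE.subst (λ M → closedForm M i N 0 + inverseKernel M (i +ℕ suc N) * K (i +ℕ suc N) i ≈ 0#)
                      (PE.sym m≡) (ClosedFormLast.closedForm-last i N)

    inverseKernel-orthogonal-≡ : ∀ m → partialSum m m (m ∸ m) ≈ 1#
    inverseKernel-orthogonal-≡ m = begin
      partialSum m m (m ∸ m)          ≡⟨ PE.cong (partialSum m m) (ℕP.n∸n≡0 m) ⟩
      inverseKernel m (m +ℕ 0) * K (m +ℕ 0) m  ≡⟨ PE.cong (λ j → inverseKernel m j * K j m) (ℕP.+-identityʳ m) ⟩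
      inverseKernel m m * K m m        ≈⟨ Diagonal.inverseKernel-diagonal m ⟩
      1#                              ∎

    inverseKernel-inverts : (a b : ℕ → Carrier) → (∀ j → b j ≈ Σ≤ j (λ i → K j i * a i)) →
                            ∀ m → Σ≤ m (λ j → inverseKernel m j * b j) ≈ a m
    inverseKernel-inverts a b b≈Ka m = begin
      Σ≤ m (λ j → inverseKernel m j * b j)
        ≈⟨ Σ≤-cong m (λ j → trans (*-congˡ (b≈Ka j)) (*-distribˡ-Σ≤ j (inverseKernel m j) _)) ⟩
      Σ≤ m (λ j → Σ≤ j (λ i → inverseKernel m j * (K j i * a i)))
        ≈⟨ Σ≤-Σ≤-exchange m (λ j i → inverseKernel m j * (K j i * a i)) ⟩
      Σ≤ m (λ i → Σ≤ (m ∸ i) (λ s → inverseKernel m (i +ℕ s) * (K (i +ℕ s) i * a i)))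
        ≈⟨ Σ≤-cong m (λ i → Σ≤-cong (m ∸ i) (λ s → *-assoc (inverseKernel m (i +ℕ s)) (K (i +ℕ s) i) (a i))) ⟨
      Σ≤ m (λ i → Σ≤ (m ∸ i) (λ s → (inverseKernel m (i +ℕ s) * K (i +ℕ s) i) * a i))
        ≈⟨ Σ≤-cong m (λ i → *-distribʳ-Σ≤ (m ∸ i) (a i) (λ s → inverseKernel m (i +ℕ s) * K (i +ℕ s) i)) ⟨
      Σ≤ m (λ i → partialSum m i (m ∸ i) * a i)
        ≈⟨ Σ≤-last m (λ i i<m → x≈0⇒x*y≈0 (inverseKernel-orthogonal-< i m i<m)) ⟩
      partialSum m m (m ∸ m) * a m
        ≈⟨ trans (*-congʳ (inverseKernel-orthogonal-≡ m)) (*-identityˡ (a m)) ⟩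
      a m ∎

  module TermwiseExpansion (a k E C q : Carrier) (a≉0 : a ≉0) (k≉0 : k ≉0) (E≉0 : E ≉0) (C≉0 : C ≉0) (q≉0 : q ≉0)
    (1−C≉0 : (1# − C) ≉0) (1−Eq²ʲ≉0 : ∀ j → (1# − E * q ^ (2 *ℕ j)) ≉0)
    (poch-q≉0 : ∀ m → poch q q m ≉0) (poch-Eq≉0 : ∀ m → poch (E * q) q m ≉0) (poch-Cq≉0 : ∀ m → poch (C * q) q m ≉0)
    (poch-q²≉0 : ∀ m → poch (q * q) (q * q) m ≉0) (poch-aq²≉0 : ∀ m → poch (a * (q * q)) (q * q) m ≉0)
    (poch-aq²ˢ⁺²≉0 : ∀ s r → poch (a * q ^ (2 *ℕ s +ℕ 2)) (q * q) r ≉0)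
    (poch-aq²q⁻²ᵗ/k≉0 : ∀ t r → poch (a * (q * q) * (q ⁻¹) ^ (2 *ℕ t) / k) (q * q) r ≉0)
    (poch-Cq²ʲ⁺¹≉0 : ∀ j r → poch (C * q ^ (2 *ℕ j +ℕ 1)) q r ≉0)
    where
    open InverseKernel E C q E≉0 1−C≉0 1−Eq²ʲ≉0 poch-q≉0 poch-Eq≉0 poch-Cq≉0

    q² q⁻¹ q⁻² : Carrier
    q² = q * q
    q⁻¹ = q ⁻¹
    q⁻² = q² ⁻¹

    q²≉0 : q² ≉0
    q²≉0 = *-≉0 q≉0 q≉0

    E/C*t≈1 : (E / C) * t ≈ 1#
    E/C*t≈1 = trans (/-*-/ C≉0 E≉0) (/-self (*-comm E C) (*-≉0 C≉0 E≉0))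

    Z : Carrier
    Z = (q² * C * a) / (k * E)

    reversalFactor-ratio-step : ∀ s → (- ((k / a) * q² ^ s)) * Z ≈ (- (q² * q² ^ s)) * t
    reversalFactor-ratio-step s = begin
      (- ((k * a ⁻¹) * q² ^ s)) * ((q² * C * a) * (k * E) ⁻¹) ≈⟨ *-congˡ (*-congˡ (⁻¹-distrib-* k≉0 E≉0)) ⟩
      (- ((k * a ⁻¹) * q² ^ s)) * ((q² * C * a) * (k ⁻¹ * E ⁻¹))
        ≈⟨ solve 8 (λ k ai ps q² C a ki Ei → (:- ((k :* ai) :* ps)) :* ((q² :* C :* a) :* (ki :* Ei))
                      := ((:- (q² :* ps)) :* (C :* Ei)) :* ((k :* ki) :* (a :* ai))) refl k (a ⁻¹) (q² ^ s) q² C a (k ⁻¹) (E ⁻¹) ⟩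
      ((- (q² * q² ^ s)) * (C * E ⁻¹)) * ((k * k ⁻¹) * (a * a ⁻¹)) ≈⟨ *-congˡ (*-cong (⁻¹-inverseʳ k≉0) (⁻¹-inverseʳ a≉0)) ⟩
      ((- (q² * q² ^ s)) * (C * E ⁻¹)) * (1# * 1#) ≈⟨ trans (*-congˡ (*-identityˡ _)) (*-identityʳ _) ⟩
      (- (q² * q² ^ s)) * t ∎

    reversalFactor-ratio : ∀ r s → reversalFactor q² (k / a) s r * Z ^ r ≈ reversalFactor q² q² s r * t ^ r
    reversalFactor-ratio zero s = refl
    reversalFactor-ratio (suc r) s = begin
      (reversalFactor q² (k / a) (suc s) r * (- ((k / a) * q² ^ s))) * (Z * Z ^ r) ≈⟨ [ab][cd]≈[ad][bc] _ _ _ _ ⟩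
      (reversalFactor q² (k / a) (suc s) r * Z ^ r) * ((- ((k / a) * q² ^ s)) * Z) ≈⟨ *-cong (reversalFactor-ratio r (suc s)) (reversalFactor-ratio-step s) ⟩
      (reversalFactor q² q² (suc s) r * t ^ r) * ((- (q² * q² ^ s)) * t) ≈⟨ [ab][cd]≈[ac][db] _ _ _ _ ⟩
      (reversalFactor q² q² (suc s) r * (- (q² * q² ^ s))) * (t * t ^ r) ∎
      where
      [ab][cd]≈[ad][bc] : ∀ a b c d → (a * b) * (c * d) ≈ (a * d) * (b * c)
      [ab][cd]≈[ad][bc] = solve 4 (λ a b c d → (a :* b) :* (c :* d) := (a :* d) :* (b :* c)) refl
      [ab][cd]≈[ac][db] : ∀ a b c d → (a * b) * (c * d) ≈ (a * c) * (d * b)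
      [ab][cd]≈[ac][db] = solve 4 (λ a b c d → (a :* b) :* (c :* d) := (a :* c) :* (d :* b)) refl

    q⁻²^n≈q⁻¹^2n : ∀ {M N'} → M PE.≡ N' → q⁻² ^ M ≈ q⁻¹ ^ (2 *ℕ N')
    q⁻²^n≈q⁻¹^2n {M} {N'} eq = begin
      q⁻² ^ M ≈⟨ ^-congʳ q⁻² eq ⟩
      q⁻² ^ N' ≈⟨ ^-congˡ N' (⁻¹-distrib-* q≉0 q≉0) ⟩
      (q⁻¹ * q⁻¹) ^ N' ≈⟨ sym (x^[2n]≈[x*x]^n q⁻¹ N') ⟩
      q⁻¹ ^ (2 *ℕ N') ∎

    q²^n≈q^2n : ∀ M → q² ^ M ≈ q ^ (2 *ℕ M)
    q²^n≈q^2n M = sym (x^[2n]≈[x*x]^n q M)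

    K′ : ℕ → ℕ → Carrier
    K′ n m = kernel a k q² n m

    -- Wn/Wd and Tn/Td are numerator and denominator of the outer factor and of the r-th inner
    -- term of β′, Kn/Kd and In/Id those of K′ n (j + r) and inverseKernel (j + r) j; the r…
    -- lemmas relate the primed factors of the kernels to the unprimed factors of β′.
    module Summand (g : ℕ → Carrier) (n j r : ℕ) (j≤n : j ≤ n) (r≤ : r ≤ n ∸ j) where
      N τ : ℕ
      N = n ∸ j
      τ = n ∸ (j +ℕ r)

      c2j KA KK EQ bC PP AP CQ e2jr PN KR ECr EJ e2j AR AK CJ QQ Zr : Carrier
      c2j = 1# − C * q ^ (2 *ℕ j)
      KA = poch (k / a) q² N
      KK = poch k q² (n +ℕ j)
      EQ = poch (E * q) q (2 *ℕ j)
      bC = 1# − C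
      PP = poch q² q² N
      AP = poch (a * q²) q² (n +ℕ j)
      CQ = poch (C * q) q (2 *ℕ j)
      e2jr = 1# − E * q ^ (2 *ℕ j +ℕ 2 *ℕ r)
      PN = poch (q⁻¹ ^ (2 *ℕ N)) q² r
      KR = poch (k * q ^ (2 *ℕ n +ℕ 2 *ℕ j)) q² r
      ECr = poch (E / C) q r
      EJ = poch (E * q ^ (2 *ℕ j)) q r
      e2j = 1# − E * q ^ (2 *ℕ j)
      AR = poch (a * q ^ (2 *ℕ n +ℕ 2 *ℕ j +ℕ 2)) q² r
      AK = poch (a * q² * q⁻¹ ^ (2 *ℕ N) / k) q² r
      CJ = poch (C * q ^ (2 *ℕ j +ℕ 1)) q r
      QQ = poch q q r
      Zr = Z ^ r

      KA' KK' PP' AP' b0' Hr' PE' Qr' CQ' bE PE2j Tr Φ1 Φ2 : Carrier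
      KA' = poch (k / a) q² τ
      KK' = poch k q² (n +ℕ (j +ℕ r))
      PP' = poch q² q² τ
      AP' = poch (a * q²) q² (n +ℕ (j +ℕ r))
      b0' = 1# − E * q ^ (2 *ℕ (j +ℕ r))
      Hr' = dualPoch t q ((j +ℕ r) ∸ j)
      PE' = poch E q ((j +ℕ r) +ℕ j)
      Qr' = poch q q ((j +ℕ r) ∸ j)
      CQ' = poch (C * q) q ((j +ℕ r) +ℕ j)
      bE = 1# − E
      PE2j = poch E q (2 *ℕ j)
      Tr = t ^ r
      Φ1 = reversalFactor q² (k / a) τ r
      Φ2 = reversalFactor q² q² τ r

      Wn Wd Tn Td Kn Kd In Id : Carrier
      Wn = c2j * KA * KK * EQ
      Wd = bC * PP * AP * CQ
      Tn = e2jr * PN * KR * ECr * EJ * g (r +ℕ j)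
      Td = e2j * AR * AK * CJ * QQ
      Kn = KA' * KK'
      Kd = PP' * AP'
      In = b0' * c2j * Hr' * PE'
      Id = bE * bC * Qr' * CQ'

      eN : N PE.≡ τ +ℕ r
      eN = PE.trans (PE.sym (ℕP.m∸n+n≡m r≤)) (PE.cong (_+ℕ r) (ℕP.∸-+-assoc n j r))
      ejrj : (j +ℕ r) ∸ j PE.≡ r
      ejrj = ℕP.m+n∸m≡n j r
      ejrj2 : (j +ℕ r) +ℕ j PE.≡ 2 *ℕ j +ℕ r
      ejrj2 = ejrj2′ j r where
        ejrj2′ : ∀ j r → j +ℕ r +ℕ j PE.≡ 2 *ℕ j +ℕ r
        ejrj2′ = solve-∀

      rKA : KA ≈ KA' * AK * Φ1
      rKA = begin
        poch (k / a) q² N ≈⟨ poch-congʳ (k / a) q² eN ⟩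
        poch (k / a) q² (τ +ℕ r) ≈⟨ poch-+ (k / a) q² τ r ⟩
        KA' * poch (k / a * q² ^ τ) q² r ≈⟨ *-congˡ (poch-reverse q²≉0 (*-≉0 k≉0 (⁻¹-≉0 a≉0)) r τ) ⟩
        KA' * (poch ((k / a) ⁻¹ * q² * q⁻² ^ (τ +ℕ r)) q² r * Φ1) ≈⟨ *-congˡ (*-congʳ (poch-congˡ q² r arg)) ⟩
        KA' * (AK * Φ1) ≈⟨ sym (*-assoc _ _ _) ⟩
        KA' * AK * Φ1 ∎
        where
        arg : (k / a) ⁻¹ * q² * q⁻² ^ (τ +ℕ r) ≈ a * q² * q⁻¹ ^ (2 *ℕ N) / k
        arg = begin
          (k * a ⁻¹) ⁻¹ * q² * q⁻² ^ (τ +ℕ r)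
            ≈⟨ *-cong (*-congʳ (trans (⁻¹-distrib-* k≉0 (⁻¹-≉0 a≉0)) (*-congˡ (⁻¹-involutive a≉0)))) (q⁻²^n≈q⁻¹^2n (PE.sym eN)) ⟩
          (k ⁻¹ * a) * q² * q⁻¹ ^ (2 *ℕ N)
            ≈⟨ solve 4 (λ k⁻¹ a q² Q → k⁻¹ :* a :* q² :* Q := a :* q² :* Q :* k⁻¹) refl (k ⁻¹) a q² (q⁻¹ ^ (2 *ℕ N)) ⟩
          a * q² * q⁻¹ ^ (2 *ℕ N) / k ∎

      rPP : PP ≈ PP' * PN * Φ2
      rPP = begin
        poch q² q² N ≈⟨ poch-congʳ q² q² eN ⟩
        poch q² q² (τ +ℕ r) ≈⟨ poch-+ q² q² τ r ⟩
        PP' * poch (q² * q² ^ τ) q² r ≈⟨ *-congˡ (poch-reverse q²≉0 q²≉0 r τ) ⟩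
        PP' * (poch (q² ⁻¹ * q² * q⁻² ^ (τ +ℕ r)) q² r * Φ2) ≈⟨ *-congˡ (*-congʳ (poch-congˡ q² r arg)) ⟩
        PP' * (PN * Φ2) ≈⟨ sym (*-assoc _ _ _) ⟩
        PP' * PN * Φ2 ∎
        where
        arg : q² ⁻¹ * q² * q⁻² ^ (τ +ℕ r) ≈ q⁻¹ ^ (2 *ℕ N)
        arg = trans (*-cong (⁻¹-inverseˡ q²≉0) (q⁻²^n≈q⁻¹^2n (PE.sym eN))) (*-identityˡ _)

      rKK' : KK' ≈ KK * KR
      rKK' = begin
        poch k q² (n +ℕ (j +ℕ r)) ≈⟨ poch-congʳ k q² (PE.sym (ℕP.+-assoc n j r)) ⟩
        poch k q² (n +ℕ j +ℕ r) ≈⟨ poch-+ k q² (n +ℕ j) r ⟩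
        KK * poch (k * q² ^ (n +ℕ j)) q² r ≈⟨ *-congˡ (poch-congˡ q² r (*-congˡ (trans (q²^n≈q^2n (n +ℕ j)) (^-congʳ q (ℕP.*-distribˡ-+ 2 n j))))) ⟩
        KK * KR ∎

      rAP' : AP' ≈ AP * AR
      rAP' = begin
        poch (a * q²) q² (n +ℕ (j +ℕ r)) ≈⟨ poch-congʳ (a * q²) q² (PE.sym (ℕP.+-assoc n j r)) ⟩
        poch (a * q²) q² (n +ℕ j +ℕ r) ≈⟨ poch-+ (a * q²) q² (n +ℕ j) r ⟩
        AP * poch (a * q² * q² ^ (n +ℕ j)) q² r ≈⟨ *-congˡ (poch-congˡ q² r arg) ⟩
        AP * AR ∎
        where
        arg : a * q² * q² ^ (n +ℕ j) ≈ a * q ^ (2 *ℕ n +ℕ 2 *ℕ j +ℕ 2)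
        arg = trans (*-assoc _ _ _) (*-congˡ (trans (q²^n≈q^2n (suc (n +ℕ j))) (^-congʳ q (2[1+n+j]≡2n+2j+2 n j))))
          where
          2[1+n+j]≡2n+2j+2 : ∀ n j → 2 *ℕ suc (n +ℕ j) PE.≡ 2 *ℕ n +ℕ 2 *ℕ j +ℕ 2
          2[1+n+j]≡2n+2j+2 = solve-∀

      rb0' : b0' ≈ e2jr
      rb0' = 1−‿cong (*-congˡ (^-congʳ q (ℕP.*-distribˡ-+ 2 j r)))

      rHr' : Hr' ≈ ECr * Tr
      rHr' = trans (reflexive (PE.cong (dualPoch t q) ejrj)) (dualPoch≈poch q E/C*t≈1 r)

      rPE' : PE' ≈ PE2j * EJ
      rPE' = trans (poch-congʳ E q ejrj2) (poch-+ E q (2 *ℕ j) r)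

      rQr' : Qr' ≈ QQ
      rQr' = poch-congʳ q q ejrj

      rCQ' : CQ' ≈ CQ * CJ
      rCQ' = trans (poch-congʳ (C * q) q ejrj2) (trans (poch-+ (C * q) q (2 *ℕ j) r) (*-congˡ (poch-congˡ q r arg)))
        where
        arg : C * q * q ^ (2 *ℕ j) ≈ C * q ^ (2 *ℕ j +ℕ 1)
        arg = trans (*-assoc _ _ _) (*-congˡ (^-congʳ q (ℕP.+-comm 1 (2 *ℕ j))))

      relE : EQ * bE ≈ PE2j * e2j
      relE = sym (trans (poch-unfoldˡ E q (2 *ℕ j)) (*-comm _ _))

      gg : Carrier
      gg = g (r +ℕ j)
      Common : Carrier
      Common = c2j * KA' * AK * KK * e2jr * PN * KR * ECr * EJ * gg * PP' * AP * AR * bC * QQ * CQ * CJ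

      lhs-factorised : (Wn * Tn * Zr) * (Kd * Id) ≈ Common * ((EQ * bE) * (Φ1 * Zr))
      lhs-factorised = solveFactorised 25 21
        (λ c2j KA KK EQ e2jr PN KR ECr EJ gg Zr PP' AP' bE bC Qr' CQ' KA' AK Φ1 AP AR QQ CQ CJ →
          ((c2j ● KA ● KK ● EQ) ● (e2jr ● PN ● KR ● ECr ● EJ ● gg) ● Zr) ● ((PP' ● AP') ● (bE ● bC ● Qr' ● CQ'))
          ≐ (c2j ● KA' ● AK ● KK ● e2jr ● PN ● KR ● ECr ● EJ ● gg ● PP' ● AP ● AR ● bC ● QQ ● CQ ● CJ)
              ● ((EQ ● bE) ● (Φ1 ● Zr)))
        (λ c2j KA' AK Φ1 KK EQ e2jr PN KR ECr EJ gg Zr PP' AP AR bE bC QQ CQ CJ →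
          c2j ∷ (KA' ● AK ● Φ1) ∷ KK ∷ EQ ∷ e2jr ∷ PN ∷ KR ∷ ECr ∷ EJ ∷ gg ∷ Zr ∷ PP' ∷ (AP ● AR) ∷ bE ∷ bC
          ∷ QQ ∷ (CQ ● CJ) ∷ KA' ∷ AK ∷ Φ1 ∷ AP ∷ AR ∷ QQ ∷ CQ ∷ CJ ∷ [])
        (c2j ∷ KA' ∷ AK ∷ Φ1 ∷ KK ∷ EQ ∷ e2jr ∷ PN ∷ KR ∷ ECr ∷ EJ ∷ gg ∷ Zr ∷ PP' ∷ AP ∷ AR ∷ bE ∷ bC ∷ QQ ∷ CQ ∷ CJ ∷ [])
        (c2j ∷ KA ∷ KK ∷ EQ ∷ e2jr ∷ PN ∷ KR ∷ ECr ∷ EJ ∷ gg ∷ Zr ∷ PP' ∷ AP' ∷ bE ∷ bC ∷ Qr' ∷ CQ' ∷ KA' ∷ AK ∷ Φ1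
          ∷ AP ∷ AR ∷ QQ ∷ CQ ∷ CJ ∷ [])
        (refl ∷ rKA ∷ refl ∷ refl ∷ refl ∷ refl ∷ refl ∷ refl ∷ refl ∷ refl ∷ refl ∷ refl ∷ rAP' ∷ refl ∷ refl
         ∷ rQr' ∷ rCQ' ∷ refl ∷ refl ∷ refl ∷ refl ∷ refl ∷ refl ∷ refl ∷ refl ∷ [])
        refl

      rhs-factorised : (gg * Kn * In) * (Wd * Td) ≈ Common * ((PE2j * e2j) * (Φ2 * Tr))
      rhs-factorised = solveFactorised 26 21
        (λ gg KA' KK' b0' c2j Hr' PE' bC PP AP CQ e2j AR AK CJ QQ KK KR e2jr PN ECr EJ PP' PE2j Φ2 Tr →
          (gg ● (KA' ● KK') ● (b0' ● c2j ● Hr' ● PE')) ● ((bC ● PP ● AP ● CQ) ● (e2j ● AR ● AK ● CJ ● QQ))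
          ≐ (c2j ● KA' ● AK ● KK ● e2jr ● PN ● KR ● ECr ● EJ ● gg ● PP' ● AP ● AR ● bC ● QQ ● CQ ● CJ)
              ● ((PE2j ● e2j) ● (Φ2 ● Tr)))
        (λ gg KA' KK KR e2jr c2j ECr Tr PE2j EJ bC PP' PN Φ2 AP CQ e2j AR AK CJ QQ →
          gg ∷ KA' ∷ (KK ● KR) ∷ e2jr ∷ c2j ∷ (ECr ● Tr) ∷ (PE2j ● EJ) ∷ bC ∷ (PP' ● PN ● Φ2) ∷ AP ∷ CQ ∷ e2j
          ∷ AR ∷ AK ∷ CJ ∷ QQ ∷ KK ∷ KR ∷ e2jr ∷ PN ∷ ECr ∷ EJ ∷ PP' ∷ PE2j ∷ Φ2 ∷ Tr ∷ [])
        (gg ∷ KA' ∷ KK ∷ KR ∷ e2jr ∷ c2j ∷ ECr ∷ Tr ∷ PE2j ∷ EJ ∷ bC ∷ PP' ∷ PN ∷ Φ2 ∷ AP ∷ CQ ∷ e2j ∷ AR ∷ AK ∷ CJ ∷ QQ ∷ [])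
        (gg ∷ KA' ∷ KK' ∷ b0' ∷ c2j ∷ Hr' ∷ PE' ∷ bC ∷ PP ∷ AP ∷ CQ ∷ e2j ∷ AR ∷ AK ∷ CJ ∷ QQ ∷ KK ∷ KR ∷ e2jr
          ∷ PN ∷ ECr ∷ EJ ∷ PP' ∷ PE2j ∷ Φ2 ∷ Tr ∷ [])
        (refl ∷ refl ∷ rKK' ∷ rb0' ∷ refl ∷ rHr' ∷ rPE' ∷ refl ∷ rPP ∷ refl ∷ refl ∷ refl ∷ refl ∷ refl ∷ refl ∷ refl
         ∷ refl ∷ refl ∷ refl ∷ refl ∷ refl ∷ refl ∷ refl ∷ refl ∷ refl ∷ refl ∷ [])
        refl

      cross : (Wn * Tn * Zr) * (Kd * Id) ≈ (gg * Kn * In) * (Wd * Td)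
      cross = trans lhs-factorised (trans (*-congˡ (*-cong relE (reversalFactor-ratio r τ))) (sym rhs-factorised))

      Wd≉0 : Wd ≉0
      Wd≉0 = *₄-≉0 1−C≉0 (poch-q²≉0 N) (poch-aq²≉0 (n +ℕ j)) (poch-Cq≉0 (2 *ℕ j))
      AR≉0 : AR ≉0
      AR≉0 = ≉0-cong (poch-congˡ q² r (*-congˡ (^-congʳ q (2[n+j]+2≡2n+2j+2 n j)))) (poch-aq²ˢ⁺²≉0 (n +ℕ j) r)
        where
        2[n+j]+2≡2n+2j+2 : ∀ n j → 2 *ℕ (n +ℕ j) +ℕ 2 PE.≡ 2 *ℕ n +ℕ 2 *ℕ j +ℕ 2
        2[n+j]+2≡2n+2j+2 = solve-∀
      Td≉0 : Td ≉0
      Td≉0 = *₅-≉0 (1−Eq²ʲ≉0 j) AR≉0 (poch-aq²q⁻²ᵗ/k≉0 N r) (poch-Cq²ʲ⁺¹≉0 j r) (poch-q≉0 r)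
      Kd≉0 : Kd ≉0
      Kd≉0 = *-≉0 (poch-q²≉0 τ) (poch-aq²≉0 (n +ℕ (j +ℕ r)))
      Id≉0 : Id ≉0
      Id≉0 = *₄-≉0 1−E≉0 1−C≉0 (poch-q≉0 ((j +ℕ r) ∸ j)) (poch-Cq≉0 ((j +ℕ r) +ℕ j))

      β′-summand : (Wn / Wd) * ((Tn / Td) * Zr) ≈ gg * (K′ n (j +ℕ r) * inverseKernel (j +ℕ r) j)
      β′-summand = begin
        (Wn / Wd) * ((Tn / Td) * Zr)         ≈⟨ x/y*[z/w*v]≈xzv/yw Wd≉0 Td≉0 ⟩
        (Wn * Tn * Zr) / (Wd * Td)           ≈⟨ cross⇒/≈/ (*-≉0 Wd≉0 Td≉0) (*-≉0 Kd≉0 Id≉0) cross ⟩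
        (gg * Kn * In) / (Kd * Id)           ≈⟨ v*[x/y*z/w]≈vxz/yw Kd≉0 Id≉0 ⟨
        gg * ((Kn / Kd) * (In / Id))         ∎

    expandedTerm : (ℕ → Carrier → Carrier → Carrier → Carrier) → (ℕ → Carrier) → ℕ → ℕ → ℕ → Carrier
    expandedTerm β g n m j = β j E C q * (g m * (K′ n m * inverseKernel m j))

    β′-expansion : (β : ℕ → Carrier → Carrier → Carrier → Carrier) (g : ℕ → Carrier) →
                   ∀ n → β′ β g a k E C q n ≈ Σ≤ n (λ j → Σ≤ (n ∸ j) (λ s → expandedTerm β g n (j +ℕ s) j))
    β′-expansion β g n = Σ≤-cong-≤ n row
      where
      outer : ℕ → Carrier
      outer j = ((1# − C * q ^ (2 *ℕ j)) * poch (k / a) q² (n ∸ j) * poch k q² (n +ℕ j) * poch (E * q) q (2 *ℕ j))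
              / ((1# − C) * poch q² q² (n ∸ j) * poch (a * q²) q² (n +ℕ j) * poch (C * q) q (2 *ℕ j))

      inner : ℕ → ℕ → Carrier
      inner j r = ((1# − E * q ^ (2 *ℕ j +ℕ 2 *ℕ r)) * poch (q⁻¹ ^ (2 *ℕ (n ∸ j))) q² r * poch (k * q ^ (2 *ℕ n +ℕ 2 *ℕ j)) q² r
                   * poch (E / C) q r * poch (E * q ^ (2 *ℕ j)) q r * g (r +ℕ j))
                / ((1# − E * q ^ (2 *ℕ j)) * poch (a * q ^ (2 *ℕ n +ℕ 2 *ℕ j +ℕ 2)) q² r
                   * poch (a * q² * q⁻¹ ^ (2 *ℕ (n ∸ j)) / k) q² r * poch (C * q ^ (2 *ℕ j +ℕ 1)) q r * poch q q r)
                * Z ^ r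

      row : ∀ j → j ≤ n → β j E C q * outer j * Σ≤ (n ∸ j) (inner j) ≈ Σ≤ (n ∸ j) (λ s → expandedTerm β g n (j +ℕ s) j)
      row j j≤n = begin
        β j E C q * outer j * Σ≤ (n ∸ j) (inner j)            ≈⟨ *-assoc _ _ _ ⟩
        β j E C q * (outer j * Σ≤ (n ∸ j) (inner j))          ≈⟨ *-congˡ (*-distribˡ-Σ≤ (n ∸ j) (outer j) (inner j)) ⟩
        β j E C q * Σ≤ (n ∸ j) (λ r → outer j * inner j r)    ≈⟨ *-distribˡ-Σ≤ (n ∸ j) (β j E C q) _ ⟩
        Σ≤ (n ∸ j) (λ r → β j E C q * (outer j * inner j r))  ≈⟨ Σ≤-cong-≤ (n ∸ j) (λ r r≤n∸j → *-congˡ (summand r r≤n∸j)) ⟩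
        Σ≤ (n ∸ j) (λ s → expandedTerm β g n (j +ℕ s) j)       ∎
        where
        summand : ∀ r → r ≤ n ∸ j → outer j * inner j r ≈ g (j +ℕ r) * (K′ n (j +ℕ r) * inverseKernel (j +ℕ r) j)
        summand r r≤n∸j = trans (Summand.β′-summand g n j r j≤n r≤n∸j) (*-congʳ (reflexive (PE.cong g (ℕP.+-comm r j))))

    expandedTerm-row : (α β : ℕ → Carrier → Carrier → Carrier → Carrier) (g : ℕ → Carrier) →
                       (∀ j → β j E C q ≈ Σ≤ j (λ i → K j i * α i E C q)) →
                       ∀ n m → Σ≤ m (expandedTerm β g n m) ≈ K′ n m * (g m * α m E C q)
    expandedTerm-row α β g β≈Kα n m = begin
      Σ≤ m (expandedTerm β g n m)                                ≈⟨ Σ≤-cong m (λ j → regroup (β j E C q) (g m) (K′ n m) (inverseKernel m j)) ⟩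
      Σ≤ m (λ j → (K′ n m * g m) * (inverseKernel m j * β j E C q)) ≈⟨ *-distribˡ-Σ≤ m (K′ n m * g m) _ ⟨
      (K′ n m * g m) * Σ≤ m (λ j → inverseKernel m j * β j E C q)   ≈⟨ *-congˡ (inverseKernel-inverts (λ i → α i E C q) (λ j → β j E C q) β≈Kα m) ⟩
      (K′ n m * g m) * α m E C q                                 ≈⟨ *-assoc _ _ _ ⟩
      K′ n m * (g m * α m E C q)                                 ∎
      where
      regroup : ∀ b x y z → b * (x * (y * z)) ≈ (y * x) * (z * b)
      regroup = solve 4 (λ b x y z → b :* (x :* (y :* z)) := (y :* x) :* (z :* b)) refl

theorem3p3 : ∀ {c ℓ : Level} (F : Field c ℓ) → let open QSeries F in
    (α β : ℕ → Carrier → Carrier → Carrier → Carrier) → IsPair α β →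
    (g : ℕ → Carrier) (e cc : Carrier) (a k q : Carrier) → Generic a k e cc q →
    ∀ n → β′ β g a k e cc q n
    ≈ Σ≤ n (λ j → kernel a k (q * q) n j * α′ α g e cc q j)
theorem3p3 F α β isPair g e cc a k q
  (q≉0 , a≉0 , k≉0 , e≉0 , c≉0 , 1−c≉0 , poch-q≉0 , poch-eq≉0 , poch-cq≉0 , poch-q²≉0 , poch-aq²≉0 ,
   1−eq²ʲ≉0 , poch-aq²ˢ⁺²≉0 , poch-aq²q⁻²ᵗ/k≉0 , poch-cq²ʲ⁺¹≉0) n = begin
  β′ β g a k e cc q n                                                ≈⟨ β′-expansion β g n ⟩
  Σ≤ n (λ j → Σ≤ (n ∸ j) (λ s → expandedTerm β g n (j +ℕ s) j))      ≈⟨ Σ≤-Σ≤-exchange n (expandedTerm β g n) ⟨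
  Σ≤ n (λ m → Σ≤ m (expandedTerm β g n m))                           ≈⟨ Σ≤-cong n (expandedTerm-row α β g β≈Kα n) ⟩
  Σ≤ n (λ j → kernel a k (q * q) n j * α′ α g e cc q j)              ∎
  where
  open QSeries F
  open SumProperties F
  open import Relation.Binary.Reasoning.Setoid setoid
  open BaileyPairs F
  open TermwiseExpansion a k e cc q a≉0 k≉0 e≉0 c≉0 q≉0 1−c≉0 1−eq²ʲ≉0 poch-q≉0 poch-eq≉0 poch-cq≉0
         poch-q²≉0 poch-aq²≉0 poch-aq²ˢ⁺²≉0 poch-aq²q⁻²ᵗ/k≉0 poch-cq²ʲ⁺¹≉0

  β≈Kα : ∀ j → β j e cc q ≈ Σ≤ j (λ i → kernel e cc q j i * α i e cc q)
  β≈Kα = isPair e cc q e≉0 poch-q≉0 poch-eq≉0
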